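{- Let $\mathcal M,\mathbf M,\mathcal W$ be as defined in the context, and $\mathbf W(x,u)=\sum_{n,k\ge0}x^nu^k\sum_{p\in\mathcal W_{n,k}}d(p)$. Then \[\mathbf W(x,u)=x(1+u)\mathbf W(x,u)+2ux^2\Big(\mathcal M(x,u)\mathbf W(x,u)+\mathbf M(x,u)\mathcal W(x,u)+\mathcal W(x,u)\tfrac{\partial}{\partial x}\big(x\mathcal M(x,u)\big)\Big),\] and explicitly \[\mathbf W(x,u) = \frac{2 u x^2}{\left((u-1)^2 x^2-2 (u+1) x+1\right)^2}.\]
   Context: Steps: $U=(1,1)$, $D=(1,-1)$, and two distinguishable horizontal steps $O_1,O_2$, each $(1,0)$. $\mathcal W_{n,k}$ is the set of lattice paths from $(0,0)$ to $(n,0)$ with steps in $\{U,D,O_1,O_2\}$ using exactly $k$ steps of type $U$ or $O_1$; $\mathcal M_{n,k}$ is the subset staying weakly above the $x$-axis. For a path $p$ with heights $p_0,\dots,p_n$, $d(p)=\sum_{i=0}^n|p_i|$. $\mathcal M(x,u)=\sum|\mathcal M_{n,k}|x^nu^k$, $\mathcal W(x,u)=\sum|\mathcal W_{n,k}|x^nu^k$, $\mathbf M(x,u)=\sum_{n,k}x^nu^k\sum_{p\in\mathcal M_{n,k}}d(p)$. -}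

module Defs where

open import Data.Bool using (Bool; true; false; _∧_)
open import Data.Nat as ℕ using (ℕ; zero; suc; _∸_; _≡ᵇ_)
open import Data.Integer as ℤ using (ℤ; +_; ∣_∣; 0ℤ; 1ℤ; -1ℤ; _≤?_)
open import Data.List using (List; []; _∷_; [_]; map; concatMap; filterᵇ; length; foldr)
open import Data.Nat.ListAction using (sum)
open import Data.Bool.ListAction using (all)
open import Relation.Nullary.Decidable using (⌊_⌋)

-- U = (1,1), D = (1,-1), O₁ = O₂ = (1,0) (distinguishable)
data Step : Set where
  U D O₁ O₂ : Step

allSteps : List Step
allSteps = U ∷ D ∷ O₁ ∷ O₂ ∷ []

δ : Step → ℤ
δ U  = 1ℤ
δ D  = -1ℤ
δ O₁ = 0ℤ
δ O₂ = 0ℤ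

paths : ℕ → List (List Step)
paths zero    = [ [] ]
paths (suc n) = concatMap (λ s → map (s ∷_) (paths n)) allSteps

heightsFrom : ℤ → List Step → List ℤ
heightsFrom h []      = h ∷ []
heightsFrom h (s ∷ p) = h ∷ heightsFrom (h ℤ.+ δ s) p

heights : List Step → List ℤ
heights = heightsFrom 0ℤ

endHeightFrom : ℤ → List Step → ℤ
endHeightFrom h []      = h
endHeightFrom h (s ∷ p) = endHeightFrom (h ℤ.+ δ s) p

endsAtZero : List Step → Bool
endsAtZero p = ⌊ endHeightFrom 0ℤ p ℤ.≟ 0ℤ ⌋

nonNegative : List Step → Bool
nonNegative p = all (λ h → ⌊ 0ℤ ≤? h ⌋) (heights p)

isUO₁ : Step → Bool
isUO₁ U  = true
isUO₁ D  = false
isUO₁ O₁ = true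
isUO₁ O₂ = false

kcount : List Step → ℕ
kcount p = length (filterᵇ isUO₁ p)

d : List Step → ℕ
d p = sum (map ∣_∣ (heights p))

𝒲 : ℕ → ℕ → List (List Step)
𝒲 n k = filterᵇ (λ p → endsAtZero p ∧ (kcount p ≡ᵇ k)) (paths n)

ℳ : ℕ → ℕ → List (List Step)
ℳ n k = filterᵇ (λ p → nonNegative p ∧ (endsAtZero p ∧ (kcount p ≡ᵇ k))) (paths n)

-- Formal power series in x, u over ℤ: f n k = [x^n u^k] f

Series : Set
Series = ℕ → ℕ → ℤ

sumTo : ℕ → (ℕ → ℤ) → ℤ
sumTo zero    f = f 0
sumTo (suc n) f = sumTo n f ℤ.+ f (suc n)

_⊕_ : Series → Series → Series
(f ⊕ g) n k = f n k ℤ.+ g n k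

_⊛_ : Series → Series → Series
(f ⊛ g) n k = sumTo n (λ i → sumTo k (λ j → f i j ℤ.* g (n ∸ i) (k ∸ j)))

infixl 6 _⊕_
infixl 7 _⊛_

_·_ : ℤ → Series → Series
(c · f) n k = c ℤ.* f n k

infixr 8 _·_

𝟙 : Series
𝟙 zero zero = 1ℤ
𝟙 _    _    = 0ℤ

𝕩 : Series
𝕩 (suc zero) zero = 1ℤ
𝕩 _          _    = 0ℤ

𝕦 : Series
𝕦 zero (suc zero) = 1ℤ
𝕦 _    _          = 0ℤ

∂x : Series → Series
∂x f n k = + (suc n) ℤ.* f (suc n) k

𝓜 : Series
𝓜 n k = + length (ℳ n k)

𝓦 : Series
𝓦 n k = + length (𝒲 n k)

𝐌 : Series
𝐌 n k = + sum (map d (ℳ n k))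

𝐖 : Series
𝐖 n k = + sum (map d (𝒲 n k))

Q : Series
Q = (𝕦 ⊕ (-1ℤ · 𝟙)) ⊛ (𝕦 ⊕ (-1ℤ · 𝟙)) ⊛ 𝕩 ⊛ 𝕩
    ⊕ (ℤ.- (+ 2)) · ((𝕦 ⊕ 𝟙) ⊛ 𝕩)
    ⊕ 𝟙

-- A closed path either starts with a horizontal step followed by a closed path, or it is
-- U q D w, split at its first return to the axis (q a Motzkin path, w closed), or it is the
-- mirror image of such a path; Motzkin paths only have the first two shapes. Lifting q by one
-- adds |q| + 1 to its area, so d(U q D w) = d(q) + |q| + 1 + d(w), and in generating functions
-- the decomposition gives the first identity together with analogous equations for 𝓦, 𝓜 and 𝐌.
-- With S = 1 − (1+u)x − 2ux²𝓜 the equation of 𝓜 gives S² = Q, that of 𝓦 gives S𝓦 = 1,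
-- differentiating the equation of x𝓜 gives S ∂ₓ(x𝓜) = 𝓜, and that of 𝐌 gives
-- S𝐌 = ux² ∂ₓ(x𝓜) 𝓜. The first identity reads S𝐖 = 2ux² (𝐌 + ∂ₓ(x𝓜)) 𝓦; multiplying it by S³
-- and substituting yields 𝐖S⁴ = 2ux². The series of Defs are read as elements of ℤ[[u]][[x]],
-- the power series ring over ℤ[[u]], where all of this is ring algebra.

module Submission where

open import Defs
open import Data.Nat using (ℕ)
open import Data.Integer using (+_)
open import Data.Product using (_×_)
open import Relation.Binary.PropositionalEquality using (_≡_)
open import Data.Product using (_,_)
open import Algebra using (CommutativeRing)

module PowerSeries {c ℓ} (R : CommutativeRing c ℓ) where

  open import Algebra.Structures using (IsCommutativeRing)
  import Algebra.Construct.Pointwise as Pointwise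
  open import Data.Nat using (ℕ; zero; suc; _∸_; _≤_; z≤n)
  open import Data.Nat.Properties using (m≤n⇒m≤1+n; ≤-refl; m∸[m∸n]≡n; m+[n∸m]≡n)
  open import Data.Product using (_,_)
  open import Function using (_∘_)
  import Relation.Binary.PropositionalEquality as ≡
  import Data.Nat as ℕ

  open CommutativeRing R
  open import Algebra.Properties.CommutativeSemigroup +-commutativeSemigroup using (interchange)
  open import Algebra.Properties.CommutativeSemigroup *-commutativeSemigroup using (x∙yz≈y∙xz)
  open import Algebra.Properties.Semiring.Mult semiring using (×-homo-+) renaming (_×_ to _×ᴿ_)
  open import Relation.Binary.Reasoning.Setoid setoid

  Σ≤ : ℕ → (ℕ → Carrier) → Carrier
  Σ≤ zero    f = f 0
  Σ≤ (suc n) f = Σ≤ n f + f (suc n)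

  Σ< : ℕ → (ℕ → Carrier) → Carrier
  Σ< zero    f = 0#
  Σ< (suc n) f = Σ≤ n f

  Σ≤-cong-≤ : ∀ n {f g : ℕ → Carrier} → (∀ {i} → i ≤ n → f i ≈ g i) → Σ≤ n f ≈ Σ≤ n g
  Σ≤-cong-≤ zero    f≈g = f≈g z≤n
  Σ≤-cong-≤ (suc n) f≈g = +-cong (Σ≤-cong-≤ n (f≈g ∘ m≤n⇒m≤1+n)) (f≈g ≤-refl)

  Σ≤-cong : ∀ n {f g : ℕ → Carrier} → (∀ i → f i ≈ g i) → Σ≤ n f ≈ Σ≤ n g
  Σ≤-cong n f≈g = Σ≤-cong-≤ n (λ {i} _ → f≈g i)

  Σ<-cong : ∀ n {f g : ℕ → Carrier} → (∀ i → f i ≈ g i) → Σ< n f ≈ Σ< n g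
  Σ<-cong zero    f≈g = refl
  Σ<-cong (suc n) f≈g = Σ≤-cong n f≈g

  Σ≤-+ : ∀ n (f g : ℕ → Carrier) → Σ≤ n (λ i → f i + g i) ≈ Σ≤ n f + Σ≤ n g
  Σ≤-+ zero    f g = refl
  Σ≤-+ (suc n) f g = trans (+-congʳ (Σ≤-+ n f g)) (interchange _ _ _ _)

  Σ<-+ : ∀ n (f g : ℕ → Carrier) → Σ< n (λ i → f i + g i) ≈ Σ< n f + Σ< n g
  Σ<-+ zero    f g = sym (+-identityˡ 0#)
  Σ<-+ (suc n) f g = Σ≤-+ n f g

  *-distribˡ-Σ≤ : ∀ n a (f : ℕ → Carrier) → a * Σ≤ n f ≈ Σ≤ n (λ i → a * f i)
  *-distribˡ-Σ≤ zero    a f = refl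
  *-distribˡ-Σ≤ (suc n) a f = trans (distribˡ a _ _) (+-congʳ (*-distribˡ-Σ≤ n a f))

  Σ≤-zero : ∀ n {f : ℕ → Carrier} → (∀ i → f i ≈ 0#) → Σ≤ n f ≈ 0#
  Σ≤-zero zero    f≈0 = f≈0 0
  Σ≤-zero (suc n) f≈0 = trans (+-cong (Σ≤-zero n f≈0) (f≈0 (suc n))) (+-identityˡ 0#)

  Σ<-zero : ∀ n {f : ℕ → Carrier} → (∀ i → f i ≈ 0#) → Σ< n f ≈ 0#
  Σ<-zero zero    f≈0 = refl
  Σ<-zero (suc n) f≈0 = Σ≤-zero n f≈0

  Σ≤-head : ∀ n (f : ℕ → Carrier) → Σ≤ n f ≈ f 0 + Σ< n (f ∘ suc)
  Σ≤-head zero          f = sym (+-identityʳ (f 0))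
  Σ≤-head (suc zero)    f = refl
  Σ≤-head (suc (suc n)) f = trans (+-congʳ (Σ≤-head (suc n) f)) (+-assoc _ _ _)

  Σ≤-reverse : ∀ n (f : ℕ → Carrier) → Σ≤ n f ≈ Σ≤ n (λ i → f (n ∸ i))
  Σ≤-reverse zero    f = refl
  Σ≤-reverse (suc n) f = sym (begin
    Σ≤ (suc n) (λ i → f (suc n ∸ i))    ≈⟨ Σ≤-head (suc n) _ ⟩
    f (suc n) + Σ≤ n (λ i → f (n ∸ i))  ≈⟨ +-congˡ (sym (Σ≤-reverse n f)) ⟩
    f (suc n) + Σ≤ n f                  ≈⟨ +-comm _ _ ⟩
    Σ≤ n f + f (suc n)                  ∎)

  FPS : Set c
  FPS = ℕ → Carrier

  _≋_ : FPS → FPS → Set ℓ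
  f ≋ g = ∀ n → f n ≈ g n

  C : Carrier → FPS
  C a zero    = a
  C a (suc _) = 0#

  1ₛ : FPS
  1ₛ = C 1#

  opaque
    _*ₛ_ : FPS → FPS → FPS
    (f *ₛ g) n = Σ≤ n (λ i → f i * g (n ∸ i))

    *ₛ-coeff : ∀ f g n → (f *ₛ g) n ≡.≡ Σ≤ n (λ i → f i * g (n ∸ i))
    *ₛ-coeff f g n = ≡.refl

    *ₛ-zero : ∀ f g → (f *ₛ g) 0 ≈ f 0 * g 0
    *ₛ-zero f g = refl

    *ₛ-suc : ∀ f g n → (f *ₛ g) (suc n) ≈ f 0 * g (suc n) + ((f ∘ suc) *ₛ g) n
    *ₛ-suc f g n = Σ≤-head (suc n) _

    *ₛ-cong : ∀ {f f′ g g′} → f ≋ f′ → g ≋ g′ → (f *ₛ g) ≋ (f′ *ₛ g′)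
    *ₛ-cong f≋f′ g≋g′ n = Σ≤-cong n (λ i → *-cong (f≋f′ i) (g≋g′ (n ∸ i)))

    *ₛ-comm : ∀ f g → (f *ₛ g) ≋ (g *ₛ f)
    *ₛ-comm f g n = begin
      Σ≤ n (λ i → f i * g (n ∸ i))              ≈⟨ Σ≤-reverse n _ ⟩
      Σ≤ n (λ i → f (n ∸ i) * g (n ∸ (n ∸ i)))  ≈⟨ Σ≤-cong-≤ n (λ {i} i≤n → trans (*-comm _ _)
                                                     (reflexive (≡.cong (λ j → g j * f (n ∸ i)) (m∸[m∸n]≡n i≤n)))) ⟩
      Σ≤ n (λ i → g i * f (n ∸ i))              ∎

    *ₛ-distribˡ : ∀ f g h → (f *ₛ (λ n → g n + h n)) ≋ (λ n → (f *ₛ g) n + (f *ₛ h) n)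
    *ₛ-distribˡ f g h n = trans (Σ≤-cong n (λ i → distribˡ _ _ _)) (Σ≤-+ n _ _)

    *ₛ-distribʳ : ∀ h f g → ((λ n → f n + g n) *ₛ h) ≋ (λ n → (f *ₛ h) n + (g *ₛ h) n)
    *ₛ-distribʳ h f g n = trans (Σ≤-cong n (λ i → distribʳ _ _ _)) (Σ≤-+ n _ _)

    *ₛ-identityˡ : ∀ g → (1ₛ *ₛ g) ≋ g
    *ₛ-identityˡ g zero    = *-identityˡ _
    *ₛ-identityˡ g (suc n) = begin
      (1ₛ *ₛ g) (suc n)                          ≈⟨ *ₛ-suc 1ₛ g n ⟩
      1# * g (suc n) + ((1ₛ ∘ suc) *ₛ g) n       ≈⟨ +-cong (*-identityˡ _) (reflexive (*ₛ-coeff (1ₛ ∘ suc) g n)) ⟩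
      g (suc n) + Σ≤ n (λ i → 0# * g (n ∸ i))    ≈⟨ +-congˡ (Σ≤-zero n (λ _ → zeroˡ _)) ⟩
      g (suc n) + 0#                             ≈⟨ +-identityʳ _ ⟩
      g (suc n)                                  ∎

    *ₛ-assoc : ∀ f g h → ((f *ₛ g) *ₛ h) ≋ (f *ₛ (g *ₛ h))
    *ₛ-assoc f g h zero    = *-assoc _ _ _
    *ₛ-assoc f g h (suc n) = begin
      ((f *ₛ g) *ₛ h) (suc n)
        ≈⟨ *ₛ-suc (f *ₛ g) h n ⟩
      (f 0 * g 0) * h (suc n) + (((f *ₛ g) ∘ suc) *ₛ h) n
        ≈⟨ +-congˡ (*ₛ-cong {g = h} {g′ = h} (*ₛ-suc f g) (λ _ → refl) n) ⟩
      (f 0 * g 0) * h (suc n) + ((λ i → f 0 * g (suc i) + ((f ∘ suc) *ₛ g) i) *ₛ h) n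
        ≈⟨ +-congˡ (*ₛ-distribʳ h _ _ n) ⟩
      (f 0 * g 0) * h (suc n) + (((λ i → f 0 * g (suc i)) *ₛ h) n + (((f ∘ suc) *ₛ g) *ₛ h) n)
        ≈⟨ +-congˡ (+-cong (sym (scalar-*ₛ n)) (*ₛ-assoc (f ∘ suc) g h n)) ⟩
      (f 0 * g 0) * h (suc n) + (f 0 * ((g ∘ suc) *ₛ h) n + ((f ∘ suc) *ₛ (g *ₛ h)) n)
        ≈⟨ sym (+-assoc _ _ _) ⟩
      ((f 0 * g 0) * h (suc n) + f 0 * ((g ∘ suc) *ₛ h) n) + ((f ∘ suc) *ₛ (g *ₛ h)) n
        ≈⟨ +-congʳ (trans (+-congʳ (*-assoc _ _ _)) (sym (distribˡ _ _ _))) ⟩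
      f 0 * (g 0 * h (suc n) + ((g ∘ suc) *ₛ h) n) + ((f ∘ suc) *ₛ (g *ₛ h)) n
        ≈⟨ +-congʳ (*-congˡ (sym (*ₛ-suc g h n))) ⟩
      f 0 * (g *ₛ h) (suc n) + ((f ∘ suc) *ₛ (g *ₛ h)) n
        ≈⟨ sym (*ₛ-suc f (g *ₛ h) n) ⟩
      (f *ₛ (g *ₛ h)) (suc n) ∎
      where
      scalar-*ₛ : ∀ n → f 0 * ((g ∘ suc) *ₛ h) n ≈ ((λ i → f 0 * g (suc i)) *ₛ h) n
      scalar-*ₛ n = trans (*-distribˡ-Σ≤ n (f 0) _) (Σ≤-cong n (λ i → sym (*-assoc _ _ _)))

  isCommutativeRingₛ : IsCommutativeRing _≋_ (λ f g n → f n + g n) _*ₛ_ (λ f n → - f n) (λ _ → 0#) 1ₛ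
  isCommutativeRingₛ = record
    { isRing = record
      { +-isAbelianGroup = Pointwise.isAbelianGroup ℕ +-isAbelianGroup
      ; *-cong           = *ₛ-cong
      ; *-assoc          = *ₛ-assoc
      ; *-identity       = *ₛ-identityˡ , λ g n → trans (*ₛ-comm g 1ₛ n) (*ₛ-identityˡ g n)
      ; distrib          = *ₛ-distribˡ , *ₛ-distribʳ
      }
    ; *-comm = *ₛ-comm
    }

  commutativeRingₛ : CommutativeRing c ℓ
  commutativeRingₛ = record { isCommutativeRing = isCommutativeRingₛ }

  X : FPS
  X (suc zero) = 1#
  X _          = 0#

  X*ₛ-zero : ∀ f → (X *ₛ f) 0 ≈ 0#
  X*ₛ-zero f = trans (*ₛ-zero X f) (zeroˡ (f 0))

  X*ₛ-suc : ∀ f n → (X *ₛ f) (suc n) ≈ f n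
  X*ₛ-suc f n = begin
    (X *ₛ f) (suc n)                      ≈⟨ *ₛ-suc X f n ⟩
    0# * f (suc n) + ((X ∘ suc) *ₛ f) n    ≈⟨ +-cong (zeroˡ _) (*ₛ-cong {g = f} X∘suc≋1ₛ (λ _ → refl) n) ⟩
    0# + (1ₛ *ₛ f) n                       ≈⟨ +-identityˡ _ ⟩
    (1ₛ *ₛ f) n                            ≈⟨ *ₛ-identityˡ f n ⟩
    f n                                    ∎
    where
    X∘suc≋1ₛ : (X ∘ suc) ≋ 1ₛ
    X∘suc≋1ₛ zero    = refl
    X∘suc≋1ₛ (suc _) = refl

  X*ₛ-cancel : ∀ {f g} → (X *ₛ f) ≋ (X *ₛ g) → f ≋ g
  X*ₛ-cancel {f} {g} Xf≋Xg n = trans (sym (X*ₛ-suc f n)) (trans (Xf≋Xg (suc n)) (X*ₛ-suc g n))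

  C*ₛ : ∀ a f n → (C a *ₛ f) n ≈ a * f n
  C*ₛ a f zero    = *ₛ-zero (C a) f
  C*ₛ a f (suc n) = trans (*ₛ-suc (C a) f n)
    (trans (+-congˡ (trans (reflexive (*ₛ-coeff (C a ∘ suc) f n)) (Σ≤-zero n (λ _ → zeroˡ _)))) (+-identityʳ _))

  constant+X* : ∀ f → f ≋ (λ n → C (f 0) n + (X *ₛ (f ∘ suc)) n)
  constant+X* f zero    = sym (trans (+-congˡ (X*ₛ-zero (f ∘ suc))) (+-identityʳ _))
  constant+X* f (suc n) = sym (trans (+-identityˡ _) (X*ₛ-suc (f ∘ suc) n))

  Θ : FPS → FPS
  Θ f n = (n ×ᴿ 1#) * f n

  ∂ : FPS → FPS
  ∂ f n = (suc n ×ᴿ 1#) * f (suc n)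

  Θ-cong : ∀ {f g} → f ≋ g → Θ f ≋ Θ g
  Θ-cong f≋g n = *-congˡ (f≋g n)

  Θ-+ : ∀ f g → Θ (λ n → f n + g n) ≋ (λ n → Θ f n + Θ g n)
  Θ-+ f g n = distribˡ _ _ _

  opaque
    unfolding _*ₛ_

    Θ-*ₛ : ∀ f g → Θ (f *ₛ g) ≋ (λ n → (Θ f *ₛ g) n + (f *ₛ Θ g) n)
    Θ-*ₛ f g n = begin
      (n ×ᴿ 1#) * Σ≤ n (λ i → f i * g (n ∸ i))
        ≈⟨ *-distribˡ-Σ≤ n _ _ ⟩
      Σ≤ n (λ i → (n ×ᴿ 1#) * (f i * g (n ∸ i)))
        ≈⟨ Σ≤-cong-≤ n (λ {i} i≤n → trans (*-congʳ (reflexive (≡.cong (_×ᴿ 1#) (≡.sym (m+[n∸m]≡n i≤n)))))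
                                         (leibniz i (n ∸ i) (f i) (g (n ∸ i)))) ⟩
      Σ≤ n (λ i → (i ×ᴿ 1#) * f i * g (n ∸ i) + f i * (((n ∸ i) ×ᴿ 1#) * g (n ∸ i)))
        ≈⟨ Σ≤-+ n _ _ ⟩
      (Θ f *ₛ g) n + (f *ₛ Θ g) n ∎
      where
      leibniz : ∀ i j a b → ((i ℕ.+ j) ×ᴿ 1#) * (a * b) ≈ (i ×ᴿ 1#) * a * b + a * ((j ×ᴿ 1#) * b)
      leibniz i j a b = trans (*-congʳ (×-homo-+ 1# i j))
        (trans (distribʳ _ _ _) (+-cong (sym (*-assoc _ _ _)) (x∙yz≈y∙xz _ _ _)))

  Θ-C : ∀ a → Θ (C a) ≋ (λ _ → 0#)
  Θ-C a zero    = zeroˡ a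
  Θ-C a (suc n) = zeroʳ _

  Θ-X : Θ X ≋ X
  Θ-X zero          = zeroˡ 0#
  Θ-X (suc zero)    = trans (*-identityʳ _) (+-identityʳ 1#)
  Θ-X (suc (suc n)) = zeroʳ _

  Θ≋X*ₛ∂ : ∀ f → Θ f ≋ (X *ₛ ∂ f)
  Θ≋X*ₛ∂ f zero    = trans (zeroˡ (f 0)) (sym (X*ₛ-zero (∂ f)))
  Θ≋X*ₛ∂ f (suc n) = sym (X*ₛ-suc (∂ f) n)

  open import Algebra.Properties.Semiring.Mult (CommutativeRing.semiring commutativeRingₛ)
    using () renaming (_×_ to _×ₛ_)

  ×ₛ-1ₛ : ∀ m → (m ×ₛ 1ₛ) ≋ C (m ×ᴿ 1#)
  ×ₛ-1ₛ zero    zero    = refl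
  ×ₛ-1ₛ zero    (suc n) = refl
  ×ₛ-1ₛ (suc m) zero    = +-congˡ (×ₛ-1ₛ m 0)
  ×ₛ-1ₛ (suc m) (suc n) = trans (+-congˡ (×ₛ-1ₛ m (suc n))) (+-identityˡ 0#)

module LatticePaths where

  open import Algebra using (AbelianGroup)
  open import Data.Bool using (Bool; true; false; _∧_; T)
  open import Data.Bool.Properties using (T-∧)
  open import Data.Bool.ListAction using (all)
  open import Data.Nat as ℕ using (ℕ; zero; suc; _∸_)
  open import Data.Nat.ListAction using (sum)
  import Data.Nat.Properties as ℕₚ
  open import Data.Integer as ℤ using (ℤ; +_; -[1+_]; 0ℤ; 1ℤ; -1ℤ; ∣_∣; _+_; _*_; -_; _≤?_)
  import Data.Integer.Properties as ℤₚ
  open import Data.Integer.Tactic.RingSolver using (solve-∀)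
  import Data.Nat.Tactic.RingSolver as ℕ-Solver
  open import Data.List using (List; []; _∷_; _++_; map; foldr; length; filterᵇ; concatMap)
  import Data.List.Properties as Listₚ
  open import Data.Product using (_,_; proj₁; proj₂)
  open import Function using (_∘_; _⇔_; mk⇔; Equivalence)
  open import Relation.Binary.PropositionalEquality
  open import Relation.Nullary.Decidable using (Dec; ⌊_⌋; does-⇔; isYes≗does; toWitness)
  open import Algebra.Properties.Group (AbelianGroup.group ℤₚ.+-0-abelianGroup) using (∙-cancelʳ)

  open PowerSeries ℤₚ.+-*-commutativeRing using (Σ≤; Σ<; Σ<-cong; Σ<-+; Σ<-zero; Σ≤-head)

  χ : Bool → ℤ
  χ true  = 1ℤ
  χ false = 0ℤ

  χ-∧ : ∀ a b → χ (a ∧ b) ≡ χ a * χ b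
  χ-∧ true  b = sym (ℤₚ.*-identityˡ (χ b))
  χ-∧ false b = refl

  χ-∧₃ : ∀ a b c → χ (a ∧ (b ∧ c)) ≡ χ a * (χ b * χ c)
  χ-∧₃ a b c = trans (χ-∧ a (b ∧ c)) (cong (χ a *_) (χ-∧ b c))

  χ-guard : ∀ b {x y : ℤ} → (T b → x ≡ y) → χ b * x ≡ χ b * y
  χ-guard true  x≡y = cong (1ℤ *_) (x≡y _)
  χ-guard false _   = refl

  T⇒∧≡ : ∀ {a} b → T a → a ∧ b ≡ b
  T⇒∧≡ {true} b _ = refl

  stepSum : (Step → ℤ) → ℤ
  stepSum g = g U + g D + g O₁ + g O₂

  pathSum : ℕ → (List Step → ℤ) → ℤ
  pathSum zero    F = F []
  pathSum (suc n) F = stepSum (λ s → pathSum n (F ∘ (s ∷_)))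

  stepSum-cong : ∀ {g h : Step → ℤ} → (∀ s → g s ≡ h s) → stepSum g ≡ stepSum h
  stepSum-cong g≡h = cong₂ _+_ (cong₂ _+_ (cong₂ _+_ (g≡h U) (g≡h D)) (g≡h O₁)) (g≡h O₂)

  stepSum-+ : ∀ g h → stepSum (λ s → g s + h s) ≡ stepSum g + stepSum h
  stepSum-+ g h = interchange (g U) (g D) (g O₁) (g O₂) (h U) (h D) (h O₁) (h O₂)
    where
    interchange : ∀ a b c d a′ b′ c′ d′ →
      (a + a′) + (b + b′) + (c + c′) + (d + d′) ≡ (a + b + c + d) + (a′ + b′ + c′ + d′)
    interchange = solve-∀

  *-distribˡ-stepSum : ∀ a g → a * stepSum g ≡ stepSum (λ s → a * g s)
  *-distribˡ-stepSum a g = distrib a (g U) (g D) (g O₁) (g O₂)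
    where
    distrib : ∀ a b c d e → a * (b + c + d + e) ≡ a * b + a * c + a * d + a * e
    distrib = solve-∀

  Σ<-stepSum : ∀ m (f : Step → ℕ → ℤ) → Σ< m (λ i → stepSum (λ s → f s i)) ≡ stepSum (λ s → Σ< m (f s))
  Σ<-stepSum m f = trans (Σ<-+ m _ _) (cong (_+ Σ< m (f O₂)) (trans (Σ<-+ m _ _) (cong (_+ Σ< m (f O₁)) (Σ<-+ m _ _))))

  pathSum-cong-length : ∀ n {F G : List Step → ℤ} → (∀ p → length p ≡ n → F p ≡ G p) → pathSum n F ≡ pathSum n G
  pathSum-cong-length zero    F≡G = F≡G [] refl
  pathSum-cong-length (suc n) F≡G = stepSum-cong (λ s → pathSum-cong-length n (λ p |p|≡n → F≡G (s ∷ p) (cong suc |p|≡n)))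

  pathSum-cong : ∀ n {F G : List Step → ℤ} → (∀ p → F p ≡ G p) → pathSum n F ≡ pathSum n G
  pathSum-cong n F≡G = pathSum-cong-length n (λ p _ → F≡G p)

  pathSum-+ : ∀ n (F G : List Step → ℤ) → pathSum n (λ p → F p + G p) ≡ pathSum n F + pathSum n G
  pathSum-+ zero    F G = refl
  pathSum-+ (suc n) F G = trans (stepSum-cong (λ s → pathSum-+ n (F ∘ (s ∷_)) (G ∘ (s ∷_))))
    (stepSum-+ (λ s → pathSum n (F ∘ (s ∷_))) (λ s → pathSum n (G ∘ (s ∷_))))

  *-distribˡ-pathSum : ∀ n a (F : List Step → ℤ) → a * pathSum n F ≡ pathSum n (λ p → a * F p)
  *-distribˡ-pathSum zero    a F = refl
  *-distribˡ-pathSum (suc n) a F = trans (*-distribˡ-stepSum a (λ s → pathSum n (F ∘ (s ∷_))))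
    (stepSum-cong (λ s → *-distribˡ-pathSum n a (F ∘ (s ∷_))))

  pathSum-zero : ∀ n {F : List Step → ℤ} → (∀ p → F p ≡ 0ℤ) → pathSum n F ≡ 0ℤ
  pathSum-zero zero    F≡0 = F≡0 []
  pathSum-zero (suc n) F≡0 = stepSum-cong (λ s → pathSum-zero n (λ p → F≡0 (s ∷ p)))

  pathSum-Σ≤ : ∀ n k (F : List Step → ℕ → ℤ) → pathSum n (λ p → Σ≤ k (F p)) ≡ Σ≤ k (λ j → pathSum n (λ p → F p j))
  pathSum-Σ≤ n zero    F = refl
  pathSum-Σ≤ n (suc k) F = trans (pathSum-+ n _ _) (cong (_+ pathSum n (λ p → F p (suc k))) (pathSum-Σ≤ n k F))

  pathSum-*-pathSum : ∀ i j (F G : List Step → ℤ) →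
    pathSum i F * pathSum j G ≡ pathSum i (λ q → pathSum j (λ w → F q * G w))
  pathSum-*-pathSum i j F G = trans (ℤₚ.*-comm (pathSum i F) _) (trans (*-distribˡ-pathSum i (pathSum j G) F)
    (pathSum-cong i (λ q → trans (ℤₚ.*-comm (pathSum j G) (F q)) (*-distribˡ-pathSum j (F q) G))))

  reflect : Step → Step
  reflect U  = D
  reflect D  = U
  reflect O₁ = O₁
  reflect O₂ = O₂

  pathSum-reflect : ∀ n (F : List Step → ℤ) → pathSum n F ≡ pathSum n (F ∘ map reflect)
  pathSum-reflect zero    F = refl
  pathSum-reflect (suc n) F = trans (stepSum-cong (λ s → pathSum-reflect n (F ∘ (s ∷_))))
    (cong (λ t → t + g O₁ + g O₂) (ℤₚ.+-comm (g U) (g D)))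
    where
    g : Step → ℤ
    g s = pathSum n (F ∘ map reflect ∘ (reflect s ∷_))

  sumℤ : List ℤ → ℤ
  sumℤ = foldr _+_ 0ℤ

  sumℤ-++ : ∀ xs ys → sumℤ (xs ++ ys) ≡ sumℤ xs + sumℤ ys
  sumℤ-++ []       ys = sym (ℤₚ.+-identityˡ _)
  sumℤ-++ (x ∷ xs) ys = trans (cong (λ t → x + t) (sumℤ-++ xs ys)) (sym (ℤₚ.+-assoc x _ _))

  sumℤ-map-concatMap : ∀ {A B : Set} (F : B → ℤ) (f : A → List B) xs →
    sumℤ (map F (concatMap f xs)) ≡ sumℤ (map (λ x → sumℤ (map F (f x))) xs)
  sumℤ-map-concatMap F f []       = refl
  sumℤ-map-concatMap F f (x ∷ xs) = begin
    sumℤ (map F (f x ++ concatMap f xs))             ≡⟨ cong sumℤ (Listₚ.map-++ F (f x) _) ⟩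
    sumℤ (map F (f x) ++ map F (concatMap f xs))     ≡⟨ sumℤ-++ (map F (f x)) _ ⟩
    sumℤ (map F (f x)) + sumℤ (map F (concatMap f xs)) ≡⟨ cong (λ t → sumℤ (map F (f x)) + t) (sumℤ-map-concatMap F f xs) ⟩
    sumℤ (map F (f x)) + sumℤ (map (λ x → sumℤ (map F (f x))) xs) ∎
    where open ≡-Reasoning

  sumℤ-map-paths : ∀ n (F : List Step → ℤ) → sumℤ (map F (paths n)) ≡ pathSum n F
  sumℤ-map-paths zero    F = ℤₚ.+-identityʳ _
  sumℤ-map-paths (suc n) F = begin
    sumℤ (map F (concatMap (λ s → map (s ∷_) (paths n)) allSteps))
      ≡⟨ sumℤ-map-concatMap F (λ s → map (s ∷_) (paths n)) allSteps ⟩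
    sumℤ (map (λ s → sumℤ (map F (map (s ∷_) (paths n)))) allSteps)
      ≡⟨ cong sumℤ (Listₚ.map-cong (λ s → trans (cong sumℤ (sym (Listₚ.map-∘ {g = F} {f = s ∷_} (paths n))))
                                                (sumℤ-map-paths n (F ∘ (s ∷_)))) allSteps) ⟩
    sumℤ (map g allSteps)
      ≡⟨ reassoc (g U) (g D) (g O₁) (g O₂) ⟩
    stepSum g ∎
    where
    open ≡-Reasoning
    reassoc : ∀ a b c d → a + (b + (c + (d + 0ℤ))) ≡ a + b + c + d
    reassoc = solve-∀
    g : Step → ℤ
    g s = pathSum n (F ∘ (s ∷_))

  length-filterᵇ : ∀ {A : Set} (P : A → Bool) xs → + length (filterᵇ P xs) ≡ sumℤ (map (χ ∘ P) xs)
  length-filterᵇ P []       = refl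
  length-filterᵇ P (x ∷ xs) with P x
  ... | true  = cong (λ t → 1ℤ + t) (length-filterᵇ P xs)
  ... | false = trans (length-filterᵇ P xs) (sym (ℤₚ.+-identityˡ _))

  sum-map-filterᵇ : ∀ {A : Set} (P : A → Bool) (f : A → ℕ) xs →
    + sum (map f (filterᵇ P xs)) ≡ sumℤ (map (λ x → χ (P x) * + f x) xs)
  sum-map-filterᵇ P f []       = refl
  sum-map-filterᵇ P f (x ∷ xs) with P x
  ... | true  = trans (ℤₚ.pos-+ (f x) _) (cong₂ _+_ (sym (ℤₚ.*-identityˡ (+ f x))) (sum-map-filterᵇ P f xs))
  ... | false = trans (sum-map-filterᵇ P f xs) (sym (ℤₚ.+-identityˡ _))

  count-paths : ∀ (P : List Step → Bool) n → + length (filterᵇ P (paths n)) ≡ pathSum n (χ ∘ P)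
  count-paths P n = trans (length-filterᵇ P (paths n)) (sumℤ-map-paths n _)

  sum-paths : ∀ (P : List Step → Bool) f n → + sum (map f (filterᵇ P (paths n))) ≡ pathSum n (λ p → χ (P p) * + f p)
  sum-paths P f n = trans (sum-map-filterᵇ P f (paths n)) (sumℤ-map-paths n _)

  ⌊⌋-⇔ : ∀ {A B : Set} → A ⇔ B → (a? : Dec A) (b? : Dec B) → ⌊ a? ⌋ ≡ ⌊ b? ⌋
  ⌊⌋-⇔ A⇔B a? b? = trans (isYes≗does a?) (trans (does-⇔ A⇔B a? b?) (sym (isYes≗does b?)))

  infix 4 _==_

  _==_ : ℤ → ℤ → Bool
  a == b = ⌊ a ℤ.≟ b ⌋

  ==-+ʳ : ∀ a b c → (a + c == b + c) ≡ (a == b)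
  ==-+ʳ a b c = ⌊⌋-⇔ (mk⇔ (∙-cancelʳ c a b) (cong (_+ c))) _ _

  ==-neg : ∀ a b → (- a == - b) ≡ (a == b)
  ==-neg a b = ⌊⌋-⇔ (mk⇔ ℤₚ.neg-injective (cong -_)) _ _

  +-rightComm : ∀ a b c → a + b + c ≡ a + c + b
  +-rightComm = solve-∀

  endHeightFrom-+ : ∀ z c q → endHeightFrom (z + c) q ≡ endHeightFrom z q + c
  endHeightFrom-+ z c []      = refl
  endHeightFrom-+ z c (s ∷ q) =
    trans (cong (λ h → endHeightFrom h q) (+-rightComm z c (δ s))) (endHeightFrom-+ (z + δ s) c q)

  endHeightFrom-++ : ∀ z q r → endHeightFrom z (q ++ r) ≡ endHeightFrom (endHeightFrom z q) r
  endHeightFrom-++ z []      r = refl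
  endHeightFrom-++ z (s ∷ q) r = endHeightFrom-++ (z + δ s) q r

  isNonNegative : ℤ → Bool
  isNonNegative h = ⌊ 0ℤ ≤? h ⌋

  nonNegativeFrom : ℤ → List Step → Bool
  nonNegativeFrom z q = all isNonNegative (heightsFrom z q)

  nonNegativeToZero : ℤ → List Step → Bool
  nonNegativeToZero z q = nonNegativeFrom z q ∧ (endHeightFrom z q == 0ℤ)

  isMotzkin : List Step → Bool
  isMotzkin = nonNegativeToZero 0ℤ

  χ-isMotzkin : ∀ q → χ (isMotzkin q) ≡ χ (nonNegative q) * χ (endsAtZero q)
  χ-isMotzkin q = χ-∧ (nonNegative q) (endsAtZero q)

  nonNegativeFrom-++ : ∀ z q r → T (nonNegativeFrom z q) →
    nonNegativeFrom z (q ++ r) ≡ nonNegativeFrom (endHeightFrom z q) r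
  nonNegativeFrom-++ z []      r _  = refl
  nonNegativeFrom-++ z (s ∷ q) r nn with Equivalence.to T-∧ nn
  ... | z≥0 , nn′ = trans (T⇒∧≡ _ z≥0) (nonNegativeFrom-++ (z + δ s) q r nn′)

  nonNegativeFrom-lift : ∀ z q → T (nonNegativeFrom z q) → T (nonNegativeFrom (z + 1ℤ) q)
  nonNegativeFrom-lift (+ n)    []      _  = _
  nonNegativeFrom-lift (+ n)    (s ∷ q) nn = subst (λ h → T (nonNegativeFrom h q)) (+-rightComm (+ n) (δ s) 1ℤ)
    (nonNegativeFrom-lift (+ n + δ s) q nn)
  nonNegativeFrom-lift -[1+ n ] []      ()
  nonNegativeFrom-lift -[1+ n ] (s ∷ q) ()

  nonNegativeFrom-below : ∀ q → nonNegativeFrom -1ℤ q ≡ false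
  nonNegativeFrom-below []      = refl
  nonNegativeFrom-below (s ∷ q) = refl

  dFrom : ℤ → List Step → ℕ
  dFrom z q = sum (map ∣_∣ (heightsFrom z q))

  dFrom-lift : ∀ z q → T (nonNegativeFrom z q) → dFrom (z + 1ℤ) q ≡ dFrom z q ℕ.+ suc (length q)
  dFrom-lift (+ n) []      _  = trans (ℕₚ.+-identityʳ (n ℕ.+ 1)) (cong (ℕ._+ 1) (sym (ℕₚ.+-identityʳ n)))
  dFrom-lift (+ n) (s ∷ q) nn = begin
    n ℕ.+ 1 ℕ.+ dFrom (+ n + 1ℤ + δ s) q                 ≡⟨ cong (λ h → n ℕ.+ 1 ℕ.+ dFrom h q) (+-rightComm (+ n) 1ℤ (δ s)) ⟩
    n ℕ.+ 1 ℕ.+ dFrom (+ n + δ s + 1ℤ) q                 ≡⟨ cong (n ℕ.+ 1 ℕ.+_) (dFrom-lift (+ n + δ s) q nn) ⟩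
    n ℕ.+ 1 ℕ.+ (dFrom (+ n + δ s) q ℕ.+ suc (length q)) ≡⟨ reassoc n (dFrom (+ n + δ s) q) (length q) ⟩
    n ℕ.+ dFrom (+ n + δ s) q ℕ.+ suc (suc (length q))   ∎
    where
    open ≡-Reasoning
    reassoc : ∀ a b c → a ℕ.+ 1 ℕ.+ (b ℕ.+ suc c) ≡ a ℕ.+ b ℕ.+ suc (suc c)
    reassoc = ℕ-Solver.solve-∀
  dFrom-lift -[1+ n ] []      ()
  dFrom-lift -[1+ n ] (s ∷ q) ()

  dFrom-++-∷ : ∀ z q s r → dFrom z (q ++ s ∷ r) ≡ dFrom z q ℕ.+ dFrom (endHeightFrom z q + δ s) r
  dFrom-++-∷ z []      s r = cong (ℕ._+ dFrom (z + δ s) r) (sym (ℕₚ.+-identityʳ ∣ z ∣))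
  dFrom-++-∷ z (t ∷ q) s r = trans (cong (∣ z ∣ ℕ.+_) (dFrom-++-∷ (z + δ t) q s r)) (sym (ℕₚ.+-assoc ∣ z ∣ _ _))

  kcount-++ : ∀ q r → kcount (q ++ r) ≡ kcount q ℕ.+ kcount r
  kcount-++ []       r = refl
  kcount-++ (U  ∷ q) r = cong suc (kcount-++ q r)
  kcount-++ (D  ∷ q) r = kcount-++ q r
  kcount-++ (O₁ ∷ q) r = cong suc (kcount-++ q r)
  kcount-++ (O₂ ∷ q) r = kcount-++ q r

  kcount-arch : ∀ q w → kcount (U ∷ q ++ D ∷ w) ≡ suc (kcount q ℕ.+ kcount w)
  kcount-arch q w = cong suc (kcount-++ q (D ∷ w))

  module _ (q : List Step) (motzkin : T (isMotzkin q)) (w : List Step) where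

    private
      nonNegative-q : T (nonNegativeFrom 0ℤ q)
      nonNegative-q = proj₁ (Equivalence.to T-∧ motzkin)

      endHeight-lifted : endHeightFrom 1ℤ q ≡ 1ℤ
      endHeight-lifted = trans (endHeightFrom-+ 0ℤ 1ℤ q)
        (cong (_+ 1ℤ) (toWitness {a? = endHeightFrom 0ℤ q ℤ.≟ 0ℤ} (proj₂ (Equivalence.to T-∧ motzkin))))

    endsAtZero-arch : endsAtZero (U ∷ q ++ D ∷ w) ≡ endsAtZero w
    endsAtZero-arch = cong (_== 0ℤ) (trans (endHeightFrom-++ 1ℤ q (D ∷ w))
      (cong (λ h → endHeightFrom (h + -1ℤ) w) endHeight-lifted))

    nonNegative-arch : nonNegative (U ∷ q ++ D ∷ w) ≡ nonNegative w
    nonNegative-arch = trans (nonNegativeFrom-++ 1ℤ q (D ∷ w) (nonNegativeFrom-lift 0ℤ q nonNegative-q))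
      (cong (λ h → nonNegativeFrom h (D ∷ w)) endHeight-lifted)

    d-arch : d (U ∷ q ++ D ∷ w) ≡ d q ℕ.+ suc (length q) ℕ.+ d w
    d-arch = begin
      dFrom 1ℤ (q ++ D ∷ w)                         ≡⟨ dFrom-++-∷ 1ℤ q D w ⟩
      dFrom 1ℤ q ℕ.+ dFrom (endHeightFrom 1ℤ q + -1ℤ) w ≡⟨ cong (λ h → dFrom 1ℤ q ℕ.+ dFrom (h + -1ℤ) w) endHeight-lifted ⟩
      dFrom 1ℤ q ℕ.+ d w                            ≡⟨ cong (ℕ._+ d w) (dFrom-lift 0ℤ q nonNegative-q) ⟩
      d q ℕ.+ suc (length q) ℕ.+ d w                ∎
      where open ≡-Reasoning

  δ-reflect : ∀ s → δ (reflect s) ≡ - δ s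
  δ-reflect U  = refl
  δ-reflect D  = refl
  δ-reflect O₁ = refl
  δ-reflect O₂ = refl

  -δ-reflect : ∀ z s → - z + δ (reflect s) ≡ - (z + δ s)
  -δ-reflect z s = trans (cong (λ e → - z + e) (δ-reflect s)) (sym (ℤₚ.neg-distrib-+ z (δ s)))

  heightsFrom-reflect : ∀ z q → heightsFrom (- z) (map reflect q) ≡ map -_ (heightsFrom z q)
  heightsFrom-reflect z []      = refl
  heightsFrom-reflect z (s ∷ q) = cong (- z ∷_)
    (trans (cong (λ h → heightsFrom h (map reflect q)) (-δ-reflect z s)) (heightsFrom-reflect (z + δ s) q))

  endHeightFrom-reflect : ∀ z q → endHeightFrom (- z) (map reflect q) ≡ - endHeightFrom z q
  endHeightFrom-reflect z []      = refl
  endHeightFrom-reflect z (s ∷ q) =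
    trans (cong (λ h → endHeightFrom h (map reflect q)) (-δ-reflect z s)) (endHeightFrom-reflect (z + δ s) q)

  d-reflect : ∀ p → d (map reflect p) ≡ d p
  d-reflect p = begin
    sum (map ∣_∣ (heightsFrom (- 0ℤ) (map reflect p))) ≡⟨ cong (sum ∘ map ∣_∣) (heightsFrom-reflect 0ℤ p) ⟩
    sum (map ∣_∣ (map -_ (heights p)))                  ≡⟨ cong sum (sym (Listₚ.map-∘ (heights p))) ⟩
    sum (map (∣_∣ ∘ -_) (heights p))                    ≡⟨ cong sum (Listₚ.map-cong ℤₚ.∣-i∣≡∣i∣ (heights p)) ⟩
    d p                                                  ∎
    where open ≡-Reasoning

  kcount-∷ : ∀ s q → + kcount (s ∷ q) ≡ χ (isUO₁ s) + + kcount q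
  kcount-∷ U  q = refl
  kcount-∷ D  q = refl
  kcount-∷ O₁ q = refl
  kcount-∷ O₂ q = refl

  -- A reflected step gains in kcount exactly what it loses in height.
  isUO₁-reflect : ∀ s → χ (isUO₁ (reflect s)) + δ s ≡ χ (isUO₁ s)
  isUO₁-reflect U  = refl
  isUO₁-reflect D  = refl
  isUO₁-reflect O₁ = refl
  isUO₁-reflect O₂ = refl

  kcount-reflect-endHeight : ∀ z q → + kcount (map reflect q) + endHeightFrom z q ≡ + kcount q + z
  kcount-reflect-endHeight z []      = refl
  kcount-reflect-endHeight z (s ∷ q) = begin
    + kcount (reflect s ∷ map reflect q) + endHeightFrom (z + δ s) q
      ≡⟨ cong (_+ endHeightFrom (z + δ s) q) (kcount-∷ (reflect s) (map reflect q)) ⟩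
    χ (isUO₁ (reflect s)) + + kcount (map reflect q) + endHeightFrom (z + δ s) q
      ≡⟨ ℤₚ.+-assoc (χ (isUO₁ (reflect s))) _ _ ⟩
    χ (isUO₁ (reflect s)) + (+ kcount (map reflect q) + endHeightFrom (z + δ s) q)
      ≡⟨ cong (λ e → χ (isUO₁ (reflect s)) + e) (kcount-reflect-endHeight (z + δ s) q) ⟩
    χ (isUO₁ (reflect s)) + (+ kcount q + (z + δ s))
      ≡⟨ regroup (χ (isUO₁ (reflect s))) (+ kcount q) z (δ s) ⟩
    (χ (isUO₁ (reflect s)) + δ s) + + kcount q + z
      ≡⟨ cong (λ a → a + + kcount q + z) (isUO₁-reflect s) ⟩
    χ (isUO₁ s) + + kcount q + z
      ≡⟨ cong (_+ z) (sym (kcount-∷ s q)) ⟩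
    + kcount (s ∷ q) + z ∎
    where
    open ≡-Reasoning
    regroup : ∀ a k z e → a + (k + (z + e)) ≡ (a + e) + k + z
    regroup = solve-∀

  kcount-reflect : ∀ p → T (endsAtZero p) → kcount (map reflect p) ≡ kcount p
  kcount-reflect p closed = ℤₚ.+-injective (∙-cancelʳ 0ℤ _ _
    (trans (cong (λ e → + kcount (map reflect p) + e) (sym (toWitness closed))) (kcount-reflect-endHeight 0ℤ p)))

  -- Σ over the decompositions q ++ D ∷ w of the paths of length n
  splitSum : ℕ → (List Step → List Step → ℤ) → ℤ
  splitSum n Φ = Σ< n (λ i → pathSum i (λ q → pathSum (n ∸ suc i) (Φ q)))

  splitSum-cong : ∀ n {Φ Ψ : List Step → List Step → ℤ} → (∀ q w → Φ q w ≡ Ψ q w) → splitSum n Φ ≡ splitSum n Ψ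
  splitSum-cong n Φ≡Ψ = Σ<-cong n (λ i → pathSum-cong i (λ q → pathSum-cong (n ∸ suc i) (Φ≡Ψ q)))

  splitSum-+ : ∀ n (Φ Ψ : List Step → List Step → ℤ) →
    splitSum n (λ q w → Φ q w + Ψ q w) ≡ splitSum n Φ + splitSum n Ψ
  splitSum-+ n Φ Ψ = trans
    (Σ<-cong n (λ i → trans (pathSum-cong i (λ q → pathSum-+ (n ∸ suc i) (Φ q) (Ψ q))) (pathSum-+ i _ _)))
    (Σ<-+ n _ _)

  splitSum-zero : ∀ n {Φ : List Step → List Step → ℤ} → (∀ q w → Φ q w ≡ 0ℤ) → splitSum n Φ ≡ 0ℤ
  splitSum-zero n Φ≡0 = Σ<-zero n (λ i → pathSum-zero i (λ q → pathSum-zero (n ∸ suc i) (Φ≡0 q)))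

  -- A path from height z ≥ 0 ending at -1 is q ++ D ∷ w, where D is its first step below the axis.
  firstDescent : ∀ m z → T (isNonNegative z) → (G : List Step → ℤ) →
    pathSum m (λ r → χ (endHeightFrom z r == -1ℤ) * G r)
      ≡ splitSum m (λ q w → χ (nonNegativeToZero z q) * (χ (endsAtZero w) * G (q ++ D ∷ w)))
  firstDescent zero    (+ h) _ G = refl
  firstDescent (suc m) (+ h) _ G = begin
    ℓ U + ℓ D + ℓ O₁ + ℓ O₂
      ≡⟨ cong₂ _+_ (cong₂ _+_ (cong₂ _+_ (firstDescent m (+ h + 1ℤ) _ (G ∘ (U ∷_))) (down h))
                                         (firstDescent m (+ h + 0ℤ) _ (G ∘ (O₁ ∷_))))
                             (firstDescent m (+ h + 0ℤ) _ (G ∘ (O₂ ∷_))) ⟩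
    σ U + (head + σ D) + σ O₁ + σ O₂
      ≡⟨ regroup (σ U) head (σ D) (σ O₁) (σ O₂) ⟩
    head + stepSum σ
      ≡⟨ cong (λ t → head + t) (sym (Σ<-stepSum m (λ s i → pathSum i (λ q → pathSum (m ∸ suc i) (Φ s q))))) ⟩
    head + Σ< m (λ i → pathSum (suc i) (λ q → pathSum (m ∸ suc i) (Φ₀ q)))
      ≡⟨ sym (Σ≤-head m (λ i → pathSum i (λ q → pathSum (suc m ∸ suc i) (Φ₀ q)))) ⟩
    splitSum (suc m) Φ₀ ∎
    where
    open ≡-Reasoning
    ℓ : Step → ℤ
    ℓ s = pathSum m (λ r → χ (endHeightFrom (+ h + δ s) r == -1ℤ) * G (s ∷ r))
    Φ₀ : List Step → List Step → ℤ
    Φ₀ q w = χ (nonNegativeToZero (+ h) q) * (χ (endsAtZero w) * G (q ++ D ∷ w))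
    Φ : Step → List Step → List Step → ℤ
    Φ s q w = Φ₀ (s ∷ q) w
    σ : Step → ℤ
    σ s = splitSum m (Φ s)
    head : ℤ
    head = pathSum m (Φ₀ [])
    regroup : ∀ a b c d e → a + (b + c) + d + e ≡ b + (a + c + d + e)
    regroup = solve-∀
    below : ∀ h → ℤ
    below h = splitSum m (λ q w → χ (nonNegativeToZero (+ h + -1ℤ) q) * (χ (endsAtZero w) * G (D ∷ q ++ D ∷ w)))
    down : ∀ h → pathSum m (λ r → χ (endHeightFrom (+ h + -1ℤ) r == -1ℤ) * G (D ∷ r))
               ≡ pathSum m (λ w → χ (nonNegativeToZero (+ h) []) * (χ (endsAtZero w) * G (D ∷ w))) + below h
    down zero    = begin
      pathSum m (λ r → χ (endHeightFrom -1ℤ r == -1ℤ) * G (D ∷ r))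
        ≡⟨ pathSum-cong m (λ r → cong (λ b → χ b * G (D ∷ r))
             (trans (cong (_== -1ℤ) (endHeightFrom-+ 0ℤ -1ℤ r)) (==-+ʳ (endHeightFrom 0ℤ r) 0ℤ -1ℤ))) ⟩
      pathSum m (λ w → χ (endsAtZero w) * G (D ∷ w))
        ≡⟨ pathSum-cong m (λ w → sym (ℤₚ.*-identityˡ _)) ⟩
      pathSum m (λ w → 1ℤ * (χ (endsAtZero w) * G (D ∷ w)))
        ≡⟨ sym (ℤₚ.+-identityʳ _) ⟩
      pathSum m (λ w → 1ℤ * (χ (endsAtZero w) * G (D ∷ w))) + 0ℤ
        ≡⟨ cong (λ t → pathSum m (λ w → 1ℤ * (χ (endsAtZero w) * G (D ∷ w))) + t) (sym (below-zero)) ⟩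
      pathSum m (λ w → 1ℤ * (χ (endsAtZero w) * G (D ∷ w))) + below 0 ∎
      where
      below-zero : below 0 ≡ 0ℤ
      below-zero = splitSum-zero m (λ q w →
        cong (λ b → χ (b ∧ (endHeightFrom -1ℤ q == 0ℤ)) * (χ (endsAtZero w) * G (D ∷ q ++ D ∷ w)))
             (nonNegativeFrom-below q))
    down (suc h) = begin
      pathSum m (λ r → χ (endHeightFrom (+ h) r == -1ℤ) * G (D ∷ r))
        ≡⟨ firstDescent m (+ h) _ (G ∘ (D ∷_)) ⟩
      below (suc h)
        ≡⟨ sym (ℤₚ.+-identityˡ _) ⟩
      0ℤ + below (suc h)
        ≡⟨ cong (_+ below (suc h)) (sym (pathSum-zero m (λ _ → refl))) ⟩
      pathSum m (λ w → 0ℤ * (χ (endsAtZero w) * G (D ∷ w))) + below (suc h) ∎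

  archSum : ℕ → (List Step → ℤ) → ℤ
  archSum n H = splitSum n (λ q w → χ (isMotzkin q) * (χ (endsAtZero w) * H (U ∷ q ++ D ∷ w)))

  pathSum-arch : ∀ n (H : List Step → ℤ) → pathSum n (λ r → χ (endHeightFrom 1ℤ r == 0ℤ) * H (U ∷ r)) ≡ archSum n H
  pathSum-arch n H = trans
    (pathSum-cong n (λ r → cong (λ b → χ b * H (U ∷ r))
      (trans (cong (_== 0ℤ) (endHeightFrom-+ 0ℤ 1ℤ r)) (==-+ʳ (endHeightFrom 0ℤ r) -1ℤ 1ℤ))))
    (firstDescent n 0ℤ _ (H ∘ (U ∷_)))

  -- A closed path starting with D is the reflection of one starting with U.
  closedSum-suc : ∀ n (H : List Step → ℤ) →
    pathSum (suc n) (λ p → χ (endsAtZero p) * H p)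
      ≡ archSum n H + archSum n (H ∘ map reflect)
        + pathSum n (λ r → χ (endsAtZero r) * H (O₁ ∷ r))
        + pathSum n (λ r → χ (endsAtZero r) * H (O₂ ∷ r))
  closedSum-suc n H = cong₂ _+_ (cong₂ _+_ (cong₂ _+_ (pathSum-arch n H) down) refl) refl
    where
    open ≡-Reasoning
    down : pathSum n (λ r → χ (endHeightFrom -1ℤ r == 0ℤ) * H (D ∷ r)) ≡ archSum n (H ∘ map reflect)
    down = begin
      pathSum n (λ r → χ (endHeightFrom -1ℤ r == 0ℤ) * H (D ∷ r))
        ≡⟨ pathSum-reflect n _ ⟩
      pathSum n (λ r → χ (endHeightFrom -1ℤ (map reflect r) == 0ℤ) * H (D ∷ map reflect r))
        ≡⟨ pathSum-cong n (λ r → cong (λ b → χ b * H (D ∷ map reflect r))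
             (trans (cong (_== 0ℤ) (endHeightFrom-reflect 1ℤ r)) (==-neg (endHeightFrom 1ℤ r) 0ℤ))) ⟩
      pathSum n (λ r → χ (endHeightFrom 1ℤ r == 0ℤ) * H (map reflect (U ∷ r)))
        ≡⟨ pathSum-arch n (H ∘ map reflect) ⟩
      archSum n (H ∘ map reflect) ∎

  archSum-cong : ∀ n {H K : List Step → ℤ} →
    (∀ q w → T (isMotzkin q) → T (endsAtZero w) → H (U ∷ q ++ D ∷ w) ≡ K (U ∷ q ++ D ∷ w)) → archSum n H ≡ archSum n K
  archSum-cong n H≡K = splitSum-cong n (λ q w → χ-guard (isMotzkin q) (λ mq →
    χ-guard (endsAtZero w) (λ ew → H≡K q w mq ew)))

  archSum-reflect : ∀ n {H : List Step → ℤ} → (∀ p → T (endsAtZero p) → H (map reflect p) ≡ H p) →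
    archSum n (H ∘ map reflect) ≡ archSum n H
  archSum-reflect n {H} H∘reflect≡H = archSum-cong n {H ∘ map reflect} {H} (λ q w mq ew →
    H∘reflect≡H (U ∷ q ++ D ∷ w) (subst T (sym (endsAtZero-arch q mq w)) ew))

  archSum-reflect-zero : ∀ n {H : List Step → ℤ} → (∀ r → H (D ∷ r) ≡ 0ℤ) → archSum n (H ∘ map reflect) ≡ 0ℤ
  archSum-reflect-zero n {H} H≡0 = splitSum-zero n (λ q w →
    trans (cong (λ h → χ (isMotzkin q) * (χ (endsAtZero w) * h)) (H≡0 (map reflect (q ++ D ∷ w))))
          (trans (cong (χ (isMotzkin q) *_) (ℤₚ.*-zeroʳ (χ (endsAtZero w)))) (ℤₚ.*-zeroʳ (χ (isMotzkin q)))))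

module GeneratingFunctions where

  open LatticePaths
  open import Data.Bool using (Bool; _∧_; T)
  open import Data.Nat as ℕ using (ℕ; zero; suc; _∸_; _≡ᵇ_)
  open import Data.Integer as ℤ using (ℤ; +_; 0ℤ; 1ℤ)
  import Data.Integer.Properties as ℤₚ
  open import Data.List using (List; _∷_; _++_; map; length; filterᵇ)
  open import Data.Nat.ListAction using (sum)
  open import Data.Integer.Tactic.RingSolver using (solve-∀)
  open import Function using (_∘_; const)
  import Relation.Binary.PropositionalEquality as ≡

  module ℤ[[u]] = PowerSeries ℤₚ.+-*-commutativeRing
  module ℤ[[u]][[x]] = PowerSeries ℤ[[u]].commutativeRingₛ

  open CommutativeRing ℤ[[u]][[x]].commutativeRingₛ
  open ℤ[[u]] using (Σ≤)

  ι : ℤ → Series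
  ι c = ℤ[[u]][[x]].C (ℤ[[u]].C c)

  Σ≤-apply : ∀ n (F : ℕ → ℤ[[u]].FPS) k → ℤ[[u]][[x]].Σ≤ n F k ≡ Σ≤ n (λ i → F i k)
  Σ≤-apply zero    F k = ≡.refl
  Σ≤-apply (suc n) F k = ≡.cong (ℤ._+ F (suc n) k) (Σ≤-apply n F k)

  *-coeff : ∀ f g n k → (f * g) n k ≡ Σ≤ n (λ i → Σ≤ k (λ j → f i j ℤ.* g (n ∸ i) (k ∸ j)))
  *-coeff f g n k = ≡.trans (≡.cong (λ h → h k) (ℤ[[u]][[x]].*ₛ-coeff f g n))
    (≡.trans (Σ≤-apply n _ k) (ℤ[[u]].Σ≤-cong n (λ i → ℤ[[u]].*ₛ-coeff (f i) (g (n ∸ i)) k)))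

  sumTo≡Σ≤ : ∀ n f → sumTo n f ≡ Σ≤ n f
  sumTo≡Σ≤ zero    f = ≡.refl
  sumTo≡Σ≤ (suc n) f = ≡.cong (ℤ._+ f (suc n)) (sumTo≡Σ≤ n f)

  ⊛≈* : ∀ f g → (f ⊛ g) ≈ f * g
  ⊛≈* f g n k = ≡.trans (sumTo≡Σ≤ n _) (≡.trans (ℤ[[u]].Σ≤-cong n (λ i → sumTo≡Σ≤ k _)) (≡.sym (*-coeff f g n k)))

  ·≈ι* : ∀ c f → (c · f) ≈ ι c * f
  ·≈ι* c f n k = ≡.sym (≡.trans (ℤ[[u]][[x]].C*ₛ (ℤ[[u]].C c) f n k) (ℤ[[u]].C*ₛ c (f n) k))

  𝟙≈1# : 𝟙 ≈ 1#
  𝟙≈1# zero    zero    = ≡.refl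
  𝟙≈1# zero    (suc k) = ≡.refl
  𝟙≈1# (suc n) k       = ≡.refl

  𝕩≈X : 𝕩 ≈ ℤ[[u]][[x]].X
  𝕩≈X zero          k       = ≡.refl
  𝕩≈X (suc zero)    zero    = ≡.refl
  𝕩≈X (suc zero)    (suc k) = ≡.refl
  𝕩≈X (suc (suc n)) k       = ≡.refl

  𝕦≈CX : 𝕦 ≈ ℤ[[u]][[x]].C ℤ[[u]].X
  𝕦≈CX zero    zero          = ≡.refl
  𝕦≈CX zero    (suc zero)    = ≡.refl
  𝕦≈CX zero    (suc (suc k)) = ≡.refl
  𝕦≈CX (suc n) k             = ≡.refl

  𝕩*-zero : ∀ F k → (𝕩 * F) 0 k ≡ 0ℤ
  𝕩*-zero F k = ≡.trans (*-congʳ {F} 𝕩≈X 0 k) (ℤ[[u]][[x]].X*ₛ-zero F k)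

  𝕩*-suc : ∀ F n k → (𝕩 * F) (suc n) k ≡ F n k
  𝕩*-suc F n k = ≡.trans (*-congʳ {F} 𝕩≈X (suc n) k) (ℤ[[u]][[x]].X*ₛ-suc F n k)

  𝕦*-coeff : ∀ F n k → (𝕦 * F) n k ≡ (ℤ[[u]].X ℤ[[u]].*ₛ F n) k
  𝕦*-coeff F n k = ≡.trans (*-congʳ {F} 𝕦≈CX n k) (ℤ[[u]][[x]].C*ₛ ℤ[[u]].X F n k)

  𝕦*-zero : ∀ F n → (𝕦 * F) n 0 ≡ 0ℤ
  𝕦*-zero F n = ≡.trans (𝕦*-coeff F n 0) (ℤ[[u]].X*ₛ-zero (F n))

  𝕦*-suc : ∀ F n k → (𝕦 * F) n (suc k) ≡ F n k
  𝕦*-suc F n k = ≡.trans (𝕦*-coeff F n (suc k)) (ℤ[[u]].X*ₛ-suc (F n) k)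

  gf : (List Step → ℤ) → Series
  gf A n k = pathSum n (λ p → A p ℤ.* χ (kcount p ≡ᵇ k))

  closed : (List Step → ℤ) → List Step → ℤ
  closed A p = χ (endsAtZero p) ℤ.* A p

  χ-convolution : ∀ k a b → Σ≤ k (λ j → χ (a ≡ᵇ j) ℤ.* χ (b ≡ᵇ k ∸ j)) ≡ χ (a ℕ.+ b ≡ᵇ k)
  χ-convolution zero    zero    b = ℤₚ.*-identityˡ _
  χ-convolution zero    (suc a) b = ≡.refl
  χ-convolution (suc k) zero    b = ≡.trans (ℤ[[u]].Σ≤-head (suc k) _)
    (≡.trans (≡.cong₂ ℤ._+_ (ℤₚ.*-identityˡ (χ (b ≡ᵇ suc k))) (ℤ[[u]].Σ≤-zero k (λ _ → ≡.refl))) (ℤₚ.+-identityʳ _))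
  χ-convolution (suc k) (suc a) b = ≡.trans (ℤ[[u]].Σ≤-head (suc k) _)
    (≡.trans (ℤₚ.+-identityˡ _) (χ-convolution k a b))

  gf-* : ∀ A B n k → (gf A * gf B) n k
    ≡ Σ≤ n (λ i → pathSum i (λ q → pathSum (n ∸ i) (λ w → A q ℤ.* B w ℤ.* χ (kcount q ℕ.+ kcount w ≡ᵇ k))))
  gf-* A B n k = ≡.trans (*-coeff (gf A) (gf B) n k) (ℤ[[u]].Σ≤-cong n (λ i → convolve i (n ∸ i)))
    where
    open ≡.≡-Reasoning
    regroup : ∀ a χa b χb → a ℤ.* χa ℤ.* (b ℤ.* χb) ≡ a ℤ.* b ℤ.* (χa ℤ.* χb)
    regroup = solve-∀
    convolve : ∀ i j → Σ≤ k (λ a → gf A i a ℤ.* gf B j (k ∸ a))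
      ≡ pathSum i (λ q → pathSum j (λ w → A q ℤ.* B w ℤ.* χ (kcount q ℕ.+ kcount w ≡ᵇ k)))
    convolve i j = begin
      Σ≤ k (λ a → gf A i a ℤ.* gf B j (k ∸ a))
        ≡⟨ ℤ[[u]].Σ≤-cong k (λ a → pathSum-*-pathSum i j _ _) ⟩
      Σ≤ k (λ a → pathSum i (λ q → pathSum j (λ w →
        A q ℤ.* χ (kcount q ≡ᵇ a) ℤ.* (B w ℤ.* χ (kcount w ≡ᵇ k ∸ a)))))
        ≡⟨ ≡.sym (pathSum-Σ≤ i k _) ⟩
      pathSum i (λ q → Σ≤ k (λ a → pathSum j (λ w →
        A q ℤ.* χ (kcount q ≡ᵇ a) ℤ.* (B w ℤ.* χ (kcount w ≡ᵇ k ∸ a)))))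
        ≡⟨ pathSum-cong i (λ q → ≡.sym (pathSum-Σ≤ j k _)) ⟩
      pathSum i (λ q → pathSum j (λ w → Σ≤ k (λ a →
        A q ℤ.* χ (kcount q ≡ᵇ a) ℤ.* (B w ℤ.* χ (kcount w ≡ᵇ k ∸ a)))))
        ≡⟨ pathSum-cong i (λ q → pathSum-cong j (λ w →
             ≡.trans (ℤ[[u]].Σ≤-cong k (λ a → regroup (A q) _ (B w) _))
                     (≡.sym (ℤ[[u]].*-distribˡ-Σ≤ k (A q ℤ.* B w) _)))) ⟩
      pathSum i (λ q → pathSum j (λ w → A q ℤ.* B w ℤ.*
        Σ≤ k (λ a → χ (kcount q ≡ᵇ a) ℤ.* χ (kcount w ≡ᵇ k ∸ a))))
        ≡⟨ pathSum-cong i (λ q → pathSum-cong j (λ w →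
             ≡.cong (A q ℤ.* B w ℤ.*_) (χ-convolution k (kcount q) (kcount w)))) ⟩
      pathSum i (λ q → pathSum j (λ w → A q ℤ.* B w ℤ.* χ (kcount q ℕ.+ kcount w ≡ᵇ k))) ∎

  -- The steps U and D around q contribute the factor x²u.
  splitSum-gf : ∀ n k A B →
    splitSum n (λ q w → A q ℤ.* B w ℤ.* χ (suc (kcount q ℕ.+ kcount w) ≡ᵇ k)) ≡ (𝕩 * (𝕦 * (gf A * gf B))) n k
  splitSum-gf zero    k       A B = ≡.sym (𝕩*-zero (𝕦 * (gf A * gf B)) k)
  splitSum-gf (suc m) zero    A B = ≡.trans
    (splitSum-zero (suc m) (λ q w → ℤₚ.*-zeroʳ (A q ℤ.* B w)))
    (≡.sym (≡.trans (𝕩*-suc (𝕦 * (gf A * gf B)) m 0) (𝕦*-zero (gf A * gf B) m)))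
  splitSum-gf (suc m) (suc k) A B =
    ≡.sym (≡.trans (𝕩*-suc (𝕦 * (gf A * gf B)) m (suc k)) (≡.trans (𝕦*-suc (gf A * gf B) m k) (gf-* A B m k)))

  gf-closed-suc : ∀ A n k →
    gf (closed A) (suc n) k
      ≡ archSum n (λ p → A p ℤ.* χ (kcount p ≡ᵇ k))
        ℤ.+ archSum n (λ p → A (map reflect p) ℤ.* χ (kcount (map reflect p) ≡ᵇ k))
        ℤ.+ (𝕦 * gf (closed (A ∘ (O₁ ∷_)))) n k ℤ.+ gf (closed (A ∘ (O₂ ∷_))) n k
  gf-closed-suc A n k = ≡.trans (pathSum-cong (suc n) (λ p → ℤₚ.*-assoc (χ (endsAtZero p)) (A p) (χ (kcount p ≡ᵇ k))))
    (≡.trans (closedSum-suc n H) (≡.cong₂ (λ a b → archSum n H ℤ.+ archSum n (H ∘ map reflect) ℤ.+ a ℤ.+ b)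
                                           (first-O₁ k) (≡.sym (reassoc n k))))
    where
    H : List Step → ℤ
    H p = A p ℤ.* χ (kcount p ≡ᵇ k)
    reassoc : ∀ {B} n k → gf (closed B) n k ≡ pathSum n (λ r → χ (endsAtZero r) ℤ.* (B r ℤ.* χ (kcount r ≡ᵇ k)))
    reassoc {B} n k = pathSum-cong n (λ r → ℤₚ.*-assoc (χ (endsAtZero r)) (B r) (χ (kcount r ≡ᵇ k)))
    first-O₁ : ∀ k → pathSum n (λ r → χ (endsAtZero r) ℤ.* (A (O₁ ∷ r) ℤ.* χ (suc (kcount r) ≡ᵇ k)))
                   ≡ (𝕦 * gf (closed (A ∘ (O₁ ∷_)))) n k
    first-O₁ zero    = ≡.trans (pathSum-zero n (λ r → ≡.trans (≡.cong (χ (endsAtZero r) ℤ.*_) (ℤₚ.*-zeroʳ (A (O₁ ∷ r))))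
                                                                (ℤₚ.*-zeroʳ (χ (endsAtZero r)))))
                               (≡.sym (𝕦*-zero (gf (closed (A ∘ (O₁ ∷_)))) n))
    first-O₁ (suc k) = ≡.sym (≡.trans (𝕦*-suc (gf (closed (A ∘ (O₁ ∷_)))) n k) (reassoc {A ∘ (O₁ ∷_)} n k))

  xu-distrib : ∀ a b c → 𝕩 * (𝕦 * (a + b + c)) ≈ 𝕩 * (𝕦 * a) + 𝕩 * (𝕦 * b) + 𝕩 * (𝕦 * c)
  xu-distrib a b c = begin
    𝕩 * (𝕦 * (a + b + c))                       ≈⟨ *-congˡ (distribˡ 𝕦 (a + b) c) ⟩
    𝕩 * (𝕦 * (a + b) + 𝕦 * c)                   ≈⟨ *-congˡ (+-congʳ (distribˡ 𝕦 a b)) ⟩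
    𝕩 * (𝕦 * a + 𝕦 * b + 𝕦 * c)                 ≈⟨ distribˡ 𝕩 _ _ ⟩
    𝕩 * (𝕦 * a + 𝕦 * b) + 𝕩 * (𝕦 * c)           ≈⟨ +-congʳ (distribˡ 𝕩 _ _) ⟩
    𝕩 * (𝕦 * a) + 𝕩 * (𝕦 * b) + 𝕩 * (𝕦 * c)    ∎
    where open import Relation.Binary.Reasoning.Setoid setoid

  splitSum-gf₃ : ∀ n k A₁ B₁ A₂ B₂ A₃ B₃ →
    splitSum n (λ q w → (A₁ q ℤ.* B₁ w ℤ.+ A₂ q ℤ.* B₂ w ℤ.+ A₃ q ℤ.* B₃ w) ℤ.* χ (suc (kcount q ℕ.+ kcount w) ≡ᵇ k))
      ≡ (𝕩 * (𝕦 * (gf A₁ * gf B₁ + gf A₂ * gf B₂ + gf A₃ * gf B₃))) n k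
  splitSum-gf₃ n k A₁ B₁ A₂ B₂ A₃ B₃ = begin
    splitSum n (λ q w → (A₁ q ℤ.* B₁ w ℤ.+ A₂ q ℤ.* B₂ w ℤ.+ A₃ q ℤ.* B₃ w) ℤ.* K q w)
      ≡⟨ splitSum-cong n (λ q w → distribʳ₃ (A₁ q ℤ.* B₁ w) (A₂ q ℤ.* B₂ w) (A₃ q ℤ.* B₃ w) (K q w)) ⟩
    splitSum n (λ q w → A₁ q ℤ.* B₁ w ℤ.* K q w ℤ.+ A₂ q ℤ.* B₂ w ℤ.* K q w ℤ.+ A₃ q ℤ.* B₃ w ℤ.* K q w)
      ≡⟨ ≡.trans (splitSum-+ n _ _) (≡.cong (ℤ._+ splitSum n (λ q w → A₃ q ℤ.* B₃ w ℤ.* K q w)) (splitSum-+ n _ _)) ⟩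
    splitSum n (λ q w → A₁ q ℤ.* B₁ w ℤ.* K q w) ℤ.+ splitSum n (λ q w → A₂ q ℤ.* B₂ w ℤ.* K q w)
      ℤ.+ splitSum n (λ q w → A₃ q ℤ.* B₃ w ℤ.* K q w)
      ≡⟨ ≡.cong₂ ℤ._+_ (≡.cong₂ ℤ._+_ (splitSum-gf n k A₁ B₁) (splitSum-gf n k A₂ B₂)) (splitSum-gf n k A₃ B₃) ⟩
    (𝕩 * (𝕦 * (gf A₁ * gf B₁)) + 𝕩 * (𝕦 * (gf A₂ * gf B₂)) + 𝕩 * (𝕦 * (gf A₃ * gf B₃))) n k
      ≡⟨ sym (xu-distrib (gf A₁ * gf B₁) (gf A₂ * gf B₂) (gf A₃ * gf B₃)) n k ⟩
    (𝕩 * (𝕦 * (gf A₁ * gf B₁ + gf A₂ * gf B₂ + gf A₃ * gf B₃))) n k ∎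
    where
    open ≡.≡-Reasoning
    K : List Step → List Step → ℤ
    K q w = χ (suc (kcount q ℕ.+ kcount w) ≡ᵇ k)
    distribʳ₃ : ∀ a b c e → (a ℤ.+ b ℤ.+ c) ℤ.* e ≡ a ℤ.* e ℤ.+ b ℤ.* e ℤ.+ c ℤ.* e
    distribʳ₃ = solve-∀

  𝓟 : Series
  𝓟 = ∂x (𝕩 ⊛ 𝓜)

  nonNegativeArea nonNegativeSize : List Step → ℤ
  nonNegativeArea p = χ (nonNegative p) ℤ.* + d p
  nonNegativeSize p = χ (nonNegative p) ℤ.* + suc (length p)

  𝓦≈gf : 𝓦 ≈ gf (closed (const 1ℤ))
  𝓦≈gf n k = ≡.trans (count-paths _ n) (pathSum-cong n (λ p →
    ≡.trans (χ-∧ (endsAtZero p) _) (≡.cong (ℤ._* χ (kcount p ≡ᵇ k)) (≡.sym (ℤₚ.*-identityʳ (χ (endsAtZero p)))))))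

  𝓜≈gf : 𝓜 ≈ gf (closed (χ ∘ nonNegative))
  𝓜≈gf n k = ≡.trans (count-paths _ n) (pathSum-cong n (λ p →
    ≡.trans (χ-∧₃ (nonNegative p) (endsAtZero p) _)
            (rearrange (χ (nonNegative p)) (χ (endsAtZero p)) (χ (kcount p ≡ᵇ k)))))
    where
    rearrange : ∀ a b c → a ℤ.* (b ℤ.* c) ≡ b ℤ.* a ℤ.* c
    rearrange = solve-∀

  𝐖≈gf : 𝐖 ≈ gf (closed (+_ ∘ d))
  𝐖≈gf n k = ≡.trans (sum-paths _ d n) (pathSum-cong n (λ p →
    ≡.trans (≡.cong (ℤ._* + d p) (χ-∧ (endsAtZero p) _))
            (rearrange (χ (endsAtZero p)) (χ (kcount p ≡ᵇ k)) (+ d p))))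
    where
    rearrange : ∀ a b c → a ℤ.* b ℤ.* c ≡ a ℤ.* c ℤ.* b
    rearrange = solve-∀

  𝐌≈gf : 𝐌 ≈ gf (closed nonNegativeArea)
  𝐌≈gf n k = ≡.trans (sum-paths _ d n) (pathSum-cong n (λ p →
    ≡.trans (≡.cong (ℤ._* + d p) (χ-∧₃ (nonNegative p) (endsAtZero p) _))
            (rearrange (χ (nonNegative p)) (χ (endsAtZero p)) (χ (kcount p ≡ᵇ k)) (+ d p))))
    where
    rearrange : ∀ a b c e → a ℤ.* (b ℤ.* c) ℤ.* e ≡ b ℤ.* (a ℤ.* e) ℤ.* c
    rearrange = solve-∀

  𝓟≈gf : 𝓟 ≈ gf (closed nonNegativeSize)
  𝓟≈gf n k = begin
    + suc n ℤ.* (𝕩 ⊛ 𝓜) (suc n) k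
      ≡⟨ ≡.cong (+ suc n ℤ.*_) (≡.trans (⊛≈* 𝕩 𝓜 (suc n) k) (≡.trans (𝕩*-suc 𝓜 n k) (𝓜≈gf n k))) ⟩
    + suc n ℤ.* gf (closed (χ ∘ nonNegative)) n k
      ≡⟨ *-distribˡ-pathSum n (+ suc n) _ ⟩
    pathSum n (λ p → + suc n ℤ.* (closed (χ ∘ nonNegative) p ℤ.* χ (kcount p ≡ᵇ k)))
      ≡⟨ pathSum-cong-length n (λ p |p|≡n → ≡.trans (≡.cong (λ m → + suc m ℤ.* _) (≡.sym |p|≡n))
           (rearrange (+ suc (length p)) (χ (endsAtZero p)) (χ (nonNegative p)) (χ (kcount p ≡ᵇ k)))) ⟩
    gf (closed nonNegativeSize) n k ∎
    where
    open ≡.≡-Reasoning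
    rearrange : ∀ l e m c → l ℤ.* (e ℤ.* m ℤ.* c) ≡ e ℤ.* (m ℤ.* l) ℤ.* c
    rearrange = solve-∀

  -- Recurrences from the first-step decomposition

  arch-summand : ∀ (A : List Step → ℤ) k q w →
    χ (isMotzkin q) ℤ.* (χ (endsAtZero w) ℤ.* (A (U ∷ q ++ D ∷ w) ℤ.* χ (kcount (U ∷ q ++ D ∷ w) ≡ᵇ k)))
      ≡ χ (isMotzkin q) ℤ.* (χ (endsAtZero w) ℤ.* A (U ∷ q ++ D ∷ w)) ℤ.* χ (suc (kcount q ℕ.+ kcount w) ≡ᵇ k)
  arch-summand A k q w =
    ≡.trans (≡.cong (λ c → χ (isMotzkin q) ℤ.* (χ (endsAtZero w) ℤ.* (A (U ∷ q ++ D ∷ w) ℤ.* χ (c ≡ᵇ k))))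
                    (kcount-arch q w))
            (reassoc (χ (isMotzkin q)) (χ (endsAtZero w)) _ _)
    where
    reassoc : ∀ a b c e → a ℤ.* (b ℤ.* (c ℤ.* e)) ≡ a ℤ.* (b ℤ.* c) ℤ.* e
    reassoc = solve-∀

  archSum-gf : ∀ n k (A A₁ B₁ : List Step → ℤ) →
    (∀ q w → χ (isMotzkin q) ℤ.* (χ (endsAtZero w) ℤ.* A (U ∷ q ++ D ∷ w)) ≡ closed A₁ q ℤ.* closed B₁ w) →
    archSum n (λ p → A p ℤ.* χ (kcount p ≡ᵇ k)) ≡ (𝕩 * (𝕦 * (gf (closed A₁) * gf (closed B₁)))) n k
  archSum-gf n k A A₁ B₁ factor = ≡.trans
    (splitSum-cong n (λ q w → ≡.trans (arch-summand A k q w) (≡.cong (ℤ._* _) (factor q w))))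
    (splitSum-gf n k (closed A₁) (closed B₁))

  archSum-gf₃ : ∀ n k (A A₁ B₁ A₂ B₂ A₃ B₃ : List Step → ℤ) →
    (∀ q w → χ (isMotzkin q) ℤ.* (χ (endsAtZero w) ℤ.* A (U ∷ q ++ D ∷ w))
             ≡ closed A₁ q ℤ.* closed B₁ w ℤ.+ closed A₂ q ℤ.* closed B₂ w ℤ.+ closed A₃ q ℤ.* closed B₃ w) →
    archSum n (λ p → A p ℤ.* χ (kcount p ≡ᵇ k))
      ≡ (𝕩 * (𝕦 * (gf (closed A₁) * gf (closed B₁) + gf (closed A₂) * gf (closed B₂)
                    + gf (closed A₃) * gf (closed B₃)))) n k
  archSum-gf₃ n k A A₁ B₁ A₂ B₂ A₃ B₃ factor = ≡.trans
    (splitSum-cong n (λ q w → ≡.trans (arch-summand A k q w) (≡.cong (ℤ._* _) (factor q w))))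
    (splitSum-gf₃ n k (closed A₁) (closed B₁) (closed A₂) (closed B₂) (closed A₃) (closed B₃))

  +d-arch : ∀ q → T (isMotzkin q) → ∀ w → + d (U ∷ q ++ D ∷ w) ≡ + d q ℤ.+ + suc (length q) ℤ.+ + d w
  +d-arch q motzkin w = ≡.trans (≡.cong +_ (d-arch q motzkin w))
    (≡.trans (ℤₚ.pos-+ (d q ℕ.+ suc (length q)) (d w)) (≡.cong (ℤ._+ + d w) (ℤₚ.pos-+ (d q) (suc (length q)))))

  x-recurrence : ∀ {f c g} → ℤ[[u]][[x]].C (f 0) ≈ c → (f ∘ suc) ≈ g → f ≈ c + 𝕩 * g
  x-recurrence {f} f₀≈c f∘suc≈g = trans (ℤ[[u]][[x]].constant+X* f) (+-cong f₀≈c (*-cong (sym 𝕩≈X) f∘suc≈g))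

  𝓦-suc : (𝓦 ∘ suc) ≈ 𝕩 * (𝕦 * (𝓜 * 𝓦)) + 𝕩 * (𝕦 * (𝓜 * 𝓦)) + 𝕦 * 𝓦 + 𝓦
  𝓦-suc n k = begin
    𝓦 (suc n) k
      ≡⟨ 𝓦≈gf (suc n) k ⟩
    gf (closed (const 1ℤ)) (suc n) k
      ≡⟨ gf-closed-suc (const 1ℤ) n k ⟩
    archSum n H ℤ.+ archSum n (H ∘ map reflect) ℤ.+ (𝕦 * gf (closed (const 1ℤ))) n k ℤ.+ gf (closed (const 1ℤ)) n k
      ≡⟨ ≡.cong₂ ℤ._+_ (≡.cong₂ ℤ._+_ (≡.cong₂ ℤ._+_ arch (≡.trans (archSum-reflect n reflect-invariant) arch))
                                     (≡.sym (*-congˡ 𝓦≈gf n k)))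
                       (≡.sym (𝓦≈gf n k)) ⟩
    (𝕩 * (𝕦 * (𝓜 * 𝓦)) + 𝕩 * (𝕦 * (𝓜 * 𝓦)) + 𝕦 * 𝓦 + 𝓦) n k ∎
    where
    open ≡.≡-Reasoning
    H : List Step → ℤ
    H p = 1ℤ ℤ.* χ (kcount p ≡ᵇ k)
    reflect-invariant : ∀ p → T (endsAtZero p) → H (map reflect p) ≡ H p
    reflect-invariant p closed-p = ≡.cong (λ c → 1ℤ ℤ.* χ (c ≡ᵇ k)) (kcount-reflect p closed-p)
    factor : ∀ q w → χ (isMotzkin q) ℤ.* (χ (endsAtZero w) ℤ.* 1ℤ) ≡ closed (χ ∘ nonNegative) q ℤ.* closed (const 1ℤ) w
    factor q w = ≡.trans (≡.cong (ℤ._* _) (χ-isMotzkin q))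
                         (rearrange (χ (nonNegative q)) (χ (endsAtZero q)) (χ (endsAtZero w) ℤ.* 1ℤ))
      where
      rearrange : ∀ a b c → a ℤ.* b ℤ.* c ≡ b ℤ.* a ℤ.* c
      rearrange = solve-∀
    arch : archSum n H ≡ (𝕩 * (𝕦 * (𝓜 * 𝓦))) n k
    arch = ≡.trans (archSum-gf n k (const 1ℤ) (χ ∘ nonNegative) (const 1ℤ) factor)
                   (≡.sym (*-congˡ (*-congˡ (*-cong 𝓜≈gf 𝓦≈gf)) n k))

  𝓜-suc : (𝓜 ∘ suc) ≈ 𝕩 * (𝕦 * (𝓜 * 𝓜)) + 𝕦 * 𝓜 + 𝓜
  𝓜-suc n k = begin
    𝓜 (suc n) k
      ≡⟨ 𝓜≈gf (suc n) k ⟩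
    gf (closed (χ ∘ nonNegative)) (suc n) k
      ≡⟨ gf-closed-suc (χ ∘ nonNegative) n k ⟩
    archSum n H ℤ.+ archSum n (H ∘ map reflect)
      ℤ.+ (𝕦 * gf (closed (χ ∘ nonNegative))) n k ℤ.+ gf (closed (χ ∘ nonNegative)) n k
      ≡⟨ ≡.cong₂ ℤ._+_ (≡.cong₂ ℤ._+_ (≡.cong₂ ℤ._+_ arch (archSum-reflect-zero n {H} below-zero))
                                     (≡.sym (*-congˡ 𝓜≈gf n k)))
                       (≡.sym (𝓜≈gf n k)) ⟩
    B n k ℤ.+ 0ℤ ℤ.+ (𝕦 * 𝓜) n k ℤ.+ 𝓜 n k
      ≡⟨ ≡.cong (λ t → t ℤ.+ (𝕦 * 𝓜) n k ℤ.+ 𝓜 n k) (ℤₚ.+-identityʳ (B n k)) ⟩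
    (B + 𝕦 * 𝓜 + 𝓜) n k ∎
    where
    open ≡.≡-Reasoning
    B : Series
    B = 𝕩 * (𝕦 * (𝓜 * 𝓜))
    H : List Step → ℤ
    H p = χ (nonNegative p) ℤ.* χ (kcount p ≡ᵇ k)
    below-zero : ∀ r → H (D ∷ r) ≡ 0ℤ
    below-zero r = ≡.cong (λ b → χ b ℤ.* χ (kcount r ≡ᵇ k)) (nonNegativeFrom-below r)
    factor : ∀ q w → χ (isMotzkin q) ℤ.* (χ (endsAtZero w) ℤ.* χ (nonNegative (U ∷ q ++ D ∷ w)))
                     ≡ closed (χ ∘ nonNegative) q ℤ.* closed (χ ∘ nonNegative) w
    factor q w = ≡.trans (χ-guard (isMotzkin q) (λ m → ≡.cong (λ b → χ (endsAtZero w) ℤ.* χ b) (nonNegative-arch q m w)))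
      (≡.trans (≡.cong (ℤ._* _) (χ-isMotzkin q))
               (rearrange (χ (nonNegative q)) (χ (endsAtZero q)) (χ (endsAtZero w) ℤ.* χ (nonNegative w))))
      where
      rearrange : ∀ a b c → a ℤ.* b ℤ.* c ≡ b ℤ.* a ℤ.* c
      rearrange = solve-∀
    arch : archSum n H ≡ B n k
    arch = ≡.trans (archSum-gf n k (χ ∘ nonNegative) (χ ∘ nonNegative) (χ ∘ nonNegative) factor)
                   (≡.sym (*-congˡ (*-congˡ (*-cong 𝓜≈gf 𝓜≈gf)) n k))

  𝐌-suc : (𝐌 ∘ suc) ≈ 𝕩 * (𝕦 * (𝐌 * 𝓜 + 𝓟 * 𝓜 + 𝓜 * 𝐌)) + 𝕦 * 𝐌 + 𝐌
  𝐌-suc n k = begin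
    𝐌 (suc n) k
      ≡⟨ 𝐌≈gf (suc n) k ⟩
    gf (closed nonNegativeArea) (suc n) k
      ≡⟨ gf-closed-suc nonNegativeArea n k ⟩
    archSum n H ℤ.+ archSum n (H ∘ map reflect)
      ℤ.+ (𝕦 * gf (closed nonNegativeArea)) n k ℤ.+ gf (closed nonNegativeArea) n k
      ≡⟨ ≡.cong₂ ℤ._+_ (≡.cong₂ ℤ._+_ (≡.cong₂ ℤ._+_ arch (archSum-reflect-zero n {H} below-zero))
                                     (≡.sym (*-congˡ 𝐌≈gf n k)))
                       (≡.sym (𝐌≈gf n k)) ⟩
    B n k ℤ.+ 0ℤ ℤ.+ (𝕦 * 𝐌) n k ℤ.+ 𝐌 n k
      ≡⟨ ≡.cong (λ t → t ℤ.+ (𝕦 * 𝐌) n k ℤ.+ 𝐌 n k) (ℤₚ.+-identityʳ (B n k)) ⟩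
    (B + 𝕦 * 𝐌 + 𝐌) n k ∎
    where
    open ≡.≡-Reasoning
    B : Series
    B = 𝕩 * (𝕦 * (𝐌 * 𝓜 + 𝓟 * 𝓜 + 𝓜 * 𝐌))
    H : List Step → ℤ
    H p = nonNegativeArea p ℤ.* χ (kcount p ≡ᵇ k)
    below-zero : ∀ r → H (D ∷ r) ≡ 0ℤ
    below-zero r = ≡.cong (λ b → χ b ℤ.* + d (D ∷ r) ℤ.* χ (kcount r ≡ᵇ k)) (nonNegativeFrom-below r)
    factor : ∀ q w → χ (isMotzkin q) ℤ.* (χ (endsAtZero w) ℤ.* nonNegativeArea (U ∷ q ++ D ∷ w))
      ≡ closed nonNegativeArea q ℤ.* closed (χ ∘ nonNegative) w ℤ.+ closed nonNegativeSize q ℤ.* closed (χ ∘ nonNegative) w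
        ℤ.+ closed (χ ∘ nonNegative) q ℤ.* closed nonNegativeArea w
    factor q w = ≡.trans
      (χ-guard (isMotzkin q) (λ m → ≡.cong₂ (λ b e → χ (endsAtZero w) ℤ.* (χ b ℤ.* e))
                                            (nonNegative-arch q m w) (+d-arch q m w)))
      (≡.trans (≡.cong (ℤ._* (χ (endsAtZero w) ℤ.* (χ (nonNegative w) ℤ.* (+ d q ℤ.+ + suc (length q) ℤ.+ + d w))))
                       (χ-isMotzkin q))
               (rearrange (χ (nonNegative q)) (χ (endsAtZero q)) (χ (endsAtZero w)) (χ (nonNegative w))
                          (+ d q) (+ suc (length q)) (+ d w)))
      where
      rearrange : ∀ nq eq ew nw dq lq dw →
        nq ℤ.* eq ℤ.* (ew ℤ.* (nw ℤ.* (dq ℤ.+ lq ℤ.+ dw)))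
          ≡ eq ℤ.* (nq ℤ.* dq) ℤ.* (ew ℤ.* nw) ℤ.+ eq ℤ.* (nq ℤ.* lq) ℤ.* (ew ℤ.* nw)
            ℤ.+ eq ℤ.* nq ℤ.* (ew ℤ.* (nw ℤ.* dw))
      rearrange = solve-∀
    arch : archSum n H ≡ B n k
    arch = ≡.trans (archSum-gf₃ n k nonNegativeArea nonNegativeArea (χ ∘ nonNegative) nonNegativeSize (χ ∘ nonNegative)
                                                    (χ ∘ nonNegative) nonNegativeArea factor)
                   (≡.sym (*-congˡ (*-congˡ (+-cong (+-cong (*-cong 𝐌≈gf 𝓜≈gf) (*-cong 𝓟≈gf 𝓜≈gf))
                                                    (*-cong 𝓜≈gf 𝐌≈gf))) n k))

  𝐖-suc : (𝐖 ∘ suc) ≈ 𝕩 * (𝕦 * (𝐌 * 𝓦 + 𝓟 * 𝓦 + 𝓜 * 𝐖)) + 𝕩 * (𝕦 * (𝐌 * 𝓦 + 𝓟 * 𝓦 + 𝓜 * 𝐖)) + 𝕦 * 𝐖 + 𝐖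
  𝐖-suc n k = begin
    𝐖 (suc n) k
      ≡⟨ 𝐖≈gf (suc n) k ⟩
    gf (closed (+_ ∘ d)) (suc n) k
      ≡⟨ gf-closed-suc (+_ ∘ d) n k ⟩
    archSum n H ℤ.+ archSum n (H ∘ map reflect) ℤ.+ (𝕦 * gf (closed (+_ ∘ d))) n k ℤ.+ gf (closed (+_ ∘ d)) n k
      ≡⟨ ≡.cong₂ ℤ._+_ (≡.cong₂ ℤ._+_ (≡.cong₂ ℤ._+_ arch (≡.trans (archSum-reflect n reflect-invariant) arch))
                                     (≡.sym (*-congˡ 𝐖≈gf n k)))
                       (≡.sym (𝐖≈gf n k)) ⟩
    (B + B + 𝕦 * 𝐖 + 𝐖) n k ∎
    where
    open ≡.≡-Reasoning
    B : Series
    B = 𝕩 * (𝕦 * (𝐌 * 𝓦 + 𝓟 * 𝓦 + 𝓜 * 𝐖))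
    H : List Step → ℤ
    H p = + d p ℤ.* χ (kcount p ≡ᵇ k)
    reflect-invariant : ∀ p → T (endsAtZero p) → H (map reflect p) ≡ H p
    reflect-invariant p closed-p = ≡.cong₂ (λ a c → + a ℤ.* χ (c ≡ᵇ k)) (d-reflect p) (kcount-reflect p closed-p)
    factor : ∀ q w → χ (isMotzkin q) ℤ.* (χ (endsAtZero w) ℤ.* + d (U ∷ q ++ D ∷ w))
      ≡ closed nonNegativeArea q ℤ.* closed (const 1ℤ) w ℤ.+ closed nonNegativeSize q ℤ.* closed (const 1ℤ) w
        ℤ.+ closed (χ ∘ nonNegative) q ℤ.* closed (+_ ∘ d) w
    factor q w = ≡.trans
      (χ-guard (isMotzkin q) (λ m → ≡.cong (χ (endsAtZero w) ℤ.*_) (+d-arch q m w)))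
      (≡.trans (≡.cong (ℤ._* (χ (endsAtZero w) ℤ.* (+ d q ℤ.+ + suc (length q) ℤ.+ + d w))) (χ-isMotzkin q))
               (rearrange (χ (nonNegative q)) (χ (endsAtZero q)) (χ (endsAtZero w)) (+ d q) (+ suc (length q)) (+ d w)))
      where
      rearrange : ∀ nq eq ew dq lq dw →
        nq ℤ.* eq ℤ.* (ew ℤ.* (dq ℤ.+ lq ℤ.+ dw))
          ≡ eq ℤ.* (nq ℤ.* dq) ℤ.* (ew ℤ.* 1ℤ) ℤ.+ eq ℤ.* (nq ℤ.* lq) ℤ.* (ew ℤ.* 1ℤ) ℤ.+ eq ℤ.* nq ℤ.* (ew ℤ.* dw)
      rearrange = solve-∀
    arch : archSum n H ≡ B n k
    arch = ≡.trans (archSum-gf₃ n k (+_ ∘ d) nonNegativeArea (const 1ℤ) nonNegativeSize (const 1ℤ)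
                                             (χ ∘ nonNegative) (+_ ∘ d) factor)
                   (≡.sym (*-congˡ (*-congˡ (+-cong (+-cong (*-cong 𝐌≈gf 𝓦≈gf) (*-cong 𝓟≈gf 𝓦≈gf))
                                                    (*-cong 𝓜≈gf 𝐖≈gf))) n k))

  𝓦-recurrence : 𝓦 ≈ 1# + 𝕩 * (𝕩 * (𝕦 * (𝓜 * 𝓦)) + 𝕩 * (𝕦 * (𝓜 * 𝓦)) + 𝕦 * 𝓦 + 𝓦)
  𝓦-recurrence = x-recurrence constant 𝓦-suc
    where
    constant : ℤ[[u]][[x]].C (𝓦 0) ≈ 1#
    constant zero    zero    = ≡.refl
    constant zero    (suc k) = ≡.refl
    constant (suc n) k       = ≡.refl

  𝓜-recurrence : 𝓜 ≈ 1# + 𝕩 * (𝕩 * (𝕦 * (𝓜 * 𝓜)) + 𝕦 * 𝓜 + 𝓜)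
  𝓜-recurrence = x-recurrence constant 𝓜-suc
    where
    constant : ℤ[[u]][[x]].C (𝓜 0) ≈ 1#
    constant zero    zero    = ≡.refl
    constant zero    (suc k) = ≡.refl
    constant (suc n) k       = ≡.refl

  𝐌-recurrence : 𝐌 ≈ 𝕩 * (𝕩 * (𝕦 * (𝐌 * 𝓜 + 𝓟 * 𝓜 + 𝓜 * 𝐌)) + 𝕦 * 𝐌 + 𝐌)
  𝐌-recurrence = trans (x-recurrence constant 𝐌-suc) (+-identityˡ _)
    where
    constant : ℤ[[u]][[x]].C (𝐌 0) ≈ 0#
    constant zero    zero    = ≡.refl
    constant zero    (suc k) = ≡.refl
    constant (suc n) k       = ≡.refl

  𝐖-recurrence : 𝐖 ≈ 𝕩 * (𝕩 * (𝕦 * (𝐌 * 𝓦 + 𝓟 * 𝓦 + 𝓜 * 𝐖)) + 𝕩 * (𝕦 * (𝐌 * 𝓦 + 𝓟 * 𝓦 + 𝓜 * 𝐖)) + 𝕦 * 𝐖 + 𝐖)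
  𝐖-recurrence = trans (x-recurrence constant 𝐖-suc) (+-identityˡ _)
    where
    constant : ℤ[[u]][[x]].C (𝐖 0) ≈ 0#
    constant zero    zero    = ≡.refl
    constant zero    (suc k) = ≡.refl
    constant (suc n) k       = ≡.refl

module FunctionalEquations where

  open GeneratingFunctions
  import Algebra.Solver.Ring
  import Algebra.Solver.Ring.AlmostCommutativeRing as ACR
  open import Data.Maybe using (Maybe; just; nothing)
  open import Data.Nat using (ℕ; zero; suc)
  open import Data.Integer as ℤ using (ℤ; +_; 0ℤ; 1ℤ; -1ℤ)
  import Data.Integer.Properties as ℤₚ
  import Relation.Binary.PropositionalEquality as ≡
  open import Relation.Nullary using (yes; no)
  open import Algebra.Properties.Semiring.Mult (CommutativeRing.semiring ℤₚ.+-*-commutativeRing)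
    using () renaming (_×_ to _×ℤ_)

  open CommutativeRing ℤ[[u]][[x]].commutativeRingₛ
  open import Relation.Binary.Reasoning.Setoid setoid

  ι-homomorphism : CommutativeRing.rawRing ℤₚ.+-*-commutativeRing ACR.-Raw-AlmostCommutative⟶
                     ACR.fromCommutativeRing ℤ[[u]][[x]].commutativeRingₛ
  ι-homomorphism = record
    { ⟦_⟧    = ι
    ; +-homo = +-homo
    ; *-homo = λ a b → trans (ι-* a b) (·≈ι* a (ι b))
    ; -‿homo = -‿homo
    ; 0-homo = 0-homo
    ; 1-homo = λ _ _ → ≡.refl
    }
    where
    +-homo : ∀ a b → ι (a ℤ.+ b) ≈ ι a + ι b
    +-homo a b zero    zero    = ≡.refl
    +-homo a b zero    (suc k) = ≡.refl
    +-homo a b (suc n) k       = ≡.refl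
    ι-* : ∀ a b → ι (a ℤ.* b) ≈ (a · ι b)
    ι-* a b zero    zero    = ≡.refl
    ι-* a b zero    (suc k) = ≡.sym (ℤₚ.*-zeroʳ a)
    ι-* a b (suc n) k       = ≡.sym (ℤₚ.*-zeroʳ a)
    -‿homo : ∀ a → ι (ℤ.- a) ≈ - ι a
    -‿homo a zero    zero    = ≡.refl
    -‿homo a zero    (suc k) = ≡.refl
    -‿homo a (suc n) k       = ≡.refl
    0-homo : ι 0ℤ ≈ 0#
    0-homo zero    zero    = ≡.refl
    0-homo zero    (suc k) = ≡.refl
    0-homo (suc n) k       = ≡.refl

  ι-≟ : ∀ a b → Maybe (ι a ≈ ι b)
  ι-≟ a b with a ℤ.≟ b
  ... | yes ≡.refl = just refl
  ... | no  _      = nothing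

  module Solver = Algebra.Solver.Ring (CommutativeRing.rawRing ℤₚ.+-*-commutativeRing)
    (ACR.fromCommutativeRing ℤ[[u]][[x]].commutativeRingₛ) ι-homomorphism ι-≟

  open Solver using (Polynomial; solve; _:=_; _:+_; _:-_; _:*_; con)

  consequence : ∀ {lhs rhs a b} c → lhs ≈ rhs + c * (a - b) → a ≈ b → lhs ≈ rhs
  consequence {lhs} {rhs} {a} {b} c lhs≈ a≈b = begin
    lhs                ≈⟨ lhs≈ ⟩
    rhs + c * (a - b)  ≈⟨ +-congˡ {rhs} (*-congˡ (trans (+-congʳ { - b} a≈b) (-‿inverseʳ b))) ⟩
    rhs + c * 0#       ≈⟨ +-congˡ {rhs} (zeroʳ c) ⟩
    rhs + 0#           ≈⟨ +-identityʳ rhs ⟩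
    rhs                ∎

  open ℤ[[u]][[x]] using (Θ; Θ-cong; Θ-+) renaming (Θ-*ₛ to Θ-*)

  Θ-𝕩 : Θ 𝕩 ≈ 𝕩
  Θ-𝕩 = trans (Θ-cong 𝕩≈X) (trans ℤ[[u]][[x]].Θ-X (sym 𝕩≈X))

  Θ-𝕦 : Θ 𝕦 ≈ 0#
  Θ-𝕦 = trans (Θ-cong 𝕦≈CX) (ℤ[[u]][[x]].Θ-C ℤ[[u]].X)

  Θ-1#+𝕦 : Θ (1# + 𝕦) ≈ 0#
  Θ-1#+𝕦 = trans (Θ-+ 1# 𝕦) (trans (+-cong (ℤ[[u]][[x]].Θ-C (CommutativeRing.1# ℤ[[u]].commutativeRingₛ)) Θ-𝕦)
    (+-identityˡ 0#))

  Θ-𝕩* : ∀ f → Θ (𝕩 * f) ≈ 𝕩 * f + 𝕩 * Θ f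
  Θ-𝕩* f = trans (Θ-* 𝕩 f) (+-congʳ (*-congʳ Θ-𝕩))

  Θ-constant* : ∀ c f → Θ c ≈ 0# → Θ (c * f) ≈ c * Θ f
  Θ-constant* c f Θc≈0 = trans (Θ-* c f) (trans (+-congʳ (trans (*-congʳ Θc≈0) (zeroˡ f))) (+-identityˡ _))

  ×ℤ-1ℤ : ∀ m → m ×ℤ 1ℤ ≡ + m
  ×ℤ-1ℤ zero    = ≡.refl
  ×ℤ-1ℤ (suc m) = ≡.cong (λ z → 1ℤ ℤ.+ z) (×ℤ-1ℤ m)

  Θ[𝕩𝓜]≈𝕩𝓟 : Θ (𝕩 * 𝓜) ≈ 𝕩 * 𝓟
  Θ[𝕩𝓜]≈𝕩𝓟 = trans (ℤ[[u]][[x]].Θ≋X*ₛ∂ (𝕩 * 𝓜)) (*-cong (sym 𝕩≈X) ∂≈𝓟)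
    where
    ∂≈𝓟 : ℤ[[u]][[x]].∂ (𝕩 * 𝓜) ≈ 𝓟
    ∂≈𝓟 n k = ≡.trans (ℤ[[u]].*ₛ-cong (ℤ[[u]].×ₛ-1ₛ (suc n)) (λ _ → ≡.refl) k)
      (≡.trans (ℤ[[u]].C*ₛ (suc n ×ℤ 1ℤ) ((𝕩 * 𝓜) (suc n)) k)
        (≡.cong₂ ℤ._*_ (×ℤ-1ℤ (suc n)) (≡.sym (⊛≈* 𝕩 𝓜 (suc n) k))))

  y-equation : 𝕩 * 𝓜 ≈ 𝕩 + (1# + 𝕦) * (𝕩 * (𝕩 * 𝓜)) + 𝕦 * (𝕩 * (𝕩 * 𝓜)) * (𝕩 * 𝓜)
  y-equation = consequence 𝕩 (solve 3 (λ x u M →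
      x :* M := x :+ (con 1ℤ :+ u) :* (x :* (x :* M)) :+ u :* (x :* (x :* M)) :* (x :* M)
                :+ x :* (M :- (con 1ℤ :+ x :* (x :* (u :* (M :* M)) :+ u :* M :+ M))))
    refl 𝕩 𝕦 𝓜) 𝓜-recurrence

  Θ-y-equation : Θ (𝕩 * 𝓜) ≈ 𝕩 + (1# + 𝕦) * (𝕩 * (𝕩 * 𝓜) + 𝕩 * Θ (𝕩 * 𝓜))
                               + 𝕦 * (𝕩 * (𝕩 * 𝓜) + 𝕩 * Θ (𝕩 * 𝓜)) * (𝕩 * 𝓜) + 𝕦 * (𝕩 * (𝕩 * 𝓜)) * Θ (𝕩 * 𝓜)
  Θ-y-equation = begin
    Θ y
      ≈⟨ Θ-cong y-equation ⟩
    Θ (𝕩 + (1# + 𝕦) * (𝕩 * y) + 𝕦 * (𝕩 * y) * y)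
      ≈⟨ trans (Θ-+ _ _) (+-congʳ (Θ-+ 𝕩 _)) ⟩
    Θ 𝕩 + Θ ((1# + 𝕦) * (𝕩 * y)) + Θ (𝕦 * (𝕩 * y) * y)
      ≈⟨ +-cong (+-cong Θ-𝕩 (trans (Θ-constant* _ _ Θ-1#+𝕦) (*-congˡ (Θ-𝕩* y))))
                (trans (Θ-* _ y) (+-congʳ (*-congʳ (trans (Θ-constant* 𝕦 _ Θ-𝕦) (*-congˡ (Θ-𝕩* y)))))) ⟩
    𝕩 + (1# + 𝕦) * (𝕩 * y + 𝕩 * Θ y) + (𝕦 * (𝕩 * y + 𝕩 * Θ y) * y + 𝕦 * (𝕩 * y) * Θ y)
      ≈⟨ sym (+-assoc (𝕩 + (1# + 𝕦) * (𝕩 * y + 𝕩 * Θ y)) (𝕦 * (𝕩 * y + 𝕩 * Θ y) * y) (𝕦 * (𝕩 * y) * Θ y)) ⟩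
    𝕩 + (1# + 𝕦) * (𝕩 * y + 𝕩 * Θ y) + 𝕦 * (𝕩 * y + 𝕩 * Θ y) * y + 𝕦 * (𝕩 * y) * Θ y ∎
    where
    y : Series
    y = 𝕩 * 𝓜

  -- Solving the functional equations

  -- S is the square root of the discriminant Q of u x² 𝓜² − (1 − (1+u) x) 𝓜 + 1 = 0, the equation of 𝓜.
  S : Series
  S = 1# - (1# + 𝕦) * 𝕩 - ι (+ 2) * 𝕦 * 𝕩 * 𝕩 * 𝓜

  S-polynomial : ∀ {m} → Polynomial m → Polynomial m → Polynomial m → Polynomial m
  S-polynomial x u M = con 1ℤ :- (con 1ℤ :+ u) :* x :- con (+ 2) :* u :* x :* x :* M

  Q′ : Series
  Q′ = (𝕦 + ι -1ℤ * 1#) * (𝕦 + ι -1ℤ * 1#) * 𝕩 * 𝕩 + ι (ℤ.- + 2) * ((𝕦 + 1#) * 𝕩) + 1#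

  S*S≈Q′ : S * S ≈ Q′
  S*S≈Q′ = consequence (ι (ℤ.- + 4) * 𝕦 * 𝕩 * 𝕩) (solve 3 (λ x u M →
      let S = S-polynomial x u M in
      S :* S := (u :+ con -1ℤ :* con 1ℤ) :* (u :+ con -1ℤ :* con 1ℤ) :* x :* x
                  :+ con (ℤ.- + 2) :* ((u :+ con 1ℤ) :* x) :+ con 1ℤ
                :+ con (ℤ.- + 4) :* u :* x :* x :* (M :- (con 1ℤ :+ x :* (x :* (u :* (M :* M)) :+ u :* M :+ M))))
    refl 𝕩 𝕦 𝓜) 𝓜-recurrence

  S*𝓜 : 𝕦 * 𝕩 * 𝕩 * 𝓜 * 𝓜 + S * 𝓜 ≈ 1#
  S*𝓜 = consequence 1# (solve 3 (λ x u M →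
      let S = S-polynomial x u M in
      u :* x :* x :* M :* M :+ S :* M := con 1ℤ :+ con 1ℤ :* (M :- (con 1ℤ :+ x :* (x :* (u :* (M :* M)) :+ u :* M :+ M))))
    refl 𝕩 𝕦 𝓜) 𝓜-recurrence

  S*𝓦 : S * 𝓦 ≈ 1#
  S*𝓦 = consequence 1# (solve 4 (λ x u M W →
      let S = S-polynomial x u M in
      S :* W := con 1ℤ :+ con 1ℤ :* (W :- (con 1ℤ :+ x :* (x :* (u :* (M :* W)) :+ x :* (u :* (M :* W)) :+ u :* W :+ W))))
    refl 𝕩 𝕦 𝓜 𝓦) 𝓦-recurrence

  S*𝓟 : S * 𝓟 ≈ 𝓜
  S*𝓟 = 𝕩-cancel (begin
    𝕩 * (S * 𝓟)       ≈⟨ solve 4 (λ x u M P → let S = S-polynomial x u M in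
                                   x :* (S :* P) := x :* P :* S) refl 𝕩 𝕦 𝓜 𝓟 ⟩
    𝕩 * 𝓟 * S         ≈⟨ *-congʳ (sym Θ[𝕩𝓜]≈𝕩𝓟) ⟩
    Θ (𝕩 * 𝓜) * S     ≈⟨ ΘyS≈y ⟩
    𝕩 * 𝓜             ∎)
    where
    𝕩-cancel : ∀ {f g} → 𝕩 * f ≈ 𝕩 * g → f ≈ g
    𝕩-cancel {f} {g} 𝕩f≈𝕩g = ℤ[[u]][[x]].X*ₛ-cancel (trans (*-congʳ (sym 𝕩≈X)) (trans 𝕩f≈𝕩g (*-congʳ 𝕩≈X)))
    ΘyS≈y : Θ (𝕩 * 𝓜) * S ≈ 𝕩 * 𝓜
    ΘyS≈y = trans (consequence 1# (solve 4 (λ x u M T →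
        let S = S-polynomial x u M in
        T :* S := x :+ (con 1ℤ :+ u) :* (x :* (x :* M)) :+ u :* (x :* (x :* M)) :* (x :* M)
                  :+ con 1ℤ :* (T :- (x :+ (con 1ℤ :+ u) :* (x :* (x :* M) :+ x :* T)
                                     :+ u :* (x :* (x :* M) :+ x :* T) :* (x :* M) :+ u :* (x :* (x :* M)) :* T)))
      refl 𝕩 𝕦 𝓜 (Θ (𝕩 * 𝓜))) Θ-y-equation) (sym y-equation)

  S*𝐌 : S * 𝐌 ≈ 𝕦 * 𝕩 * 𝕩 * 𝓟 * 𝓜
  S*𝐌 = consequence 1# (solve 5 (λ x u M P Mb →
      let S = S-polynomial x u M in
      S :* Mb := u :* x :* x :* P :* M
                 :+ con 1ℤ :* (Mb :- x :* (x :* (u :* (Mb :* M :+ P :* M :+ M :* Mb)) :+ u :* Mb :+ Mb)))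
    refl 𝕩 𝕦 𝓜 𝓟 𝐌) 𝐌-recurrence

  S*𝐖 : S * 𝐖 ≈ ι (+ 2) * 𝕦 * 𝕩 * 𝕩 * (𝐌 + 𝓟) * 𝓦
  S*𝐖 = consequence 1# (solve 7 (λ x u M W P Mb Wb →
      let S = S-polynomial x u M
          B = x :* (u :* (Mb :* W :+ P :* W :+ M :* Wb)) in
      S :* Wb := con (+ 2) :* u :* x :* x :* (Mb :+ P) :* W
                 :+ con 1ℤ :* (Wb :- x :* (B :+ B :+ u :* Wb :+ Wb)))
    refl 𝕩 𝕦 𝓜 𝓦 𝓟 𝐌 𝐖) 𝐖-recurrence

  𝐖*Q′*Q′ : 𝐖 * (Q′ * Q′) ≈ ι (+ 2) * (𝕦 * 𝕩 * 𝕩)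
  𝐖*Q′*Q′ = begin
    𝐖 * (Q′ * Q′)
      ≈⟨ *-congˡ (*-cong (sym S*S≈Q′) (sym S*S≈Q′)) ⟩
    𝐖 * ((S * S) * (S * S))
      ≈⟨ solve 2 (λ s Wb → Wb :* ((s :* s) :* (s :* s)) := s :* s :* s :* (s :* Wb)) refl S 𝐖 ⟩
    S * S * S * (S * 𝐖)
      ≈⟨ *-congˡ S*𝐖 ⟩
    S * S * S * (ι (+ 2) * 𝕦 * 𝕩 * 𝕩 * (𝐌 + 𝓟) * 𝓦)
      ≈⟨ solve 7 (λ s x u W P Mb Wb →
           s :* s :* s :* (con (+ 2) :* u :* x :* x :* (Mb :+ P) :* W)
             := con (+ 2) :* u :* x :* x :* (s :* W) :* (s :* (s :* Mb :+ s :* P)))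
           refl S 𝕩 𝕦 𝓦 𝓟 𝐌 𝐖 ⟩
    ι (+ 2) * 𝕦 * 𝕩 * 𝕩 * (S * 𝓦) * (S * (S * 𝐌 + S * 𝓟))
      ≈⟨ *-cong (*-congˡ S*𝓦) (*-congˡ (+-cong S*𝐌 S*𝓟)) ⟩
    ι (+ 2) * 𝕦 * 𝕩 * 𝕩 * 1# * (S * (𝕦 * 𝕩 * 𝕩 * 𝓟 * 𝓜 + 𝓜))
      ≈⟨ solve 5 (λ s x u M P →
           con (+ 2) :* u :* x :* x :* con 1ℤ :* (s :* (u :* x :* x :* P :* M :+ M))
             := con (+ 2) :* (u :* x :* x) :* (u :* x :* x :* M :* (s :* P) :+ s :* M))
           refl S 𝕩 𝕦 𝓜 𝓟 ⟩
    ι (+ 2) * (𝕦 * 𝕩 * 𝕩) * (𝕦 * 𝕩 * 𝕩 * 𝓜 * (S * 𝓟) + S * 𝓜)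
      ≈⟨ *-congˡ (+-congʳ (*-congˡ S*𝓟)) ⟩
    ι (+ 2) * (𝕦 * 𝕩 * 𝕩) * (𝕦 * 𝕩 * 𝕩 * 𝓜 * 𝓜 + S * 𝓜)
      ≈⟨ *-congˡ S*𝓜 ⟩
    ι (+ 2) * (𝕦 * 𝕩 * 𝕩) * 1#
      ≈⟨ *-identityʳ _ ⟩
    ι (+ 2) * (𝕦 * 𝕩 * 𝕩) ∎

  ⊛-≈ : ∀ {f f′ g g′} → f ≈ f′ → g ≈ g′ → (f ⊛ g) ≈ f′ * g′
  ⊛-≈ {f} {g = g} f≈f′ g≈g′ = trans (⊛≈* f g) (*-cong f≈f′ g≈g′)

  ·-≈ : ∀ c {f f′} → f ≈ f′ → (c · f) ≈ ι c * f′
  ·-≈ c {f} f≈f′ = trans (·≈ι* c f) (*-congˡ f≈f′)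

  Q≈Q′ : Q ≈ Q′
  Q≈Q′ = +-cong (+-cong (⊛-≈ (⊛-≈ (⊛-≈ 𝕦-1 𝕦-1) (refl {𝕩})) (refl {𝕩}))
                        (·-≈ (ℤ.- + 2) (⊛-≈ (+-cong (refl {𝕦}) 𝟙≈1#) (refl {𝕩}))))
                𝟙≈1#
    where
    𝕦-1 : (𝕦 ⊕ (-1ℤ · 𝟙)) ≈ 𝕦 + ι -1ℤ * 1#
    𝕦-1 = +-cong (refl {𝕦}) (·-≈ -1ℤ 𝟙≈1#)

  𝐖-equation : ∀ (n k : ℕ) →
    𝐖 n k ≡ ((𝕩 ⊛ (𝟙 ⊕ 𝕦) ⊛ 𝐖) ⊕ (+ 2) · (𝕦 ⊛ 𝕩 ⊛ 𝕩 ⊛ (𝓜 ⊛ 𝐖 ⊕ 𝐌 ⊛ 𝓦 ⊕ 𝓦 ⊛ ∂x (𝕩 ⊛ 𝓜)))) n k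
  𝐖-equation = trans 𝐖-recurrence (trans (solve 7 (λ x u W M P Mb Wb →
      let B = x :* (u :* (Mb :* W :+ P :* W :+ M :* Wb)) in
      x :* (B :+ B :+ u :* Wb :+ Wb)
        := x :* (con 1ℤ :+ u) :* Wb :+ con (+ 2) :* (u :* x :* x :* (M :* Wb :+ Mb :* W :+ W :* P)))
    refl 𝕩 𝕦 𝓦 𝓜 𝓟 𝐌 𝐖) (sym rhs≈))
    where
    rhs≈ : ((𝕩 ⊛ (𝟙 ⊕ 𝕦) ⊛ 𝐖) ⊕ (+ 2) · (𝕦 ⊛ 𝕩 ⊛ 𝕩 ⊛ (𝓜 ⊛ 𝐖 ⊕ 𝐌 ⊛ 𝓦 ⊕ 𝓦 ⊛ ∂x (𝕩 ⊛ 𝓜))))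
           ≈ 𝕩 * (1# + 𝕦) * 𝐖 + ι (+ 2) * (𝕦 * 𝕩 * 𝕩 * (𝓜 * 𝐖 + 𝐌 * 𝓦 + 𝓦 * 𝓟))
    rhs≈ = +-cong (⊛-≈ (⊛-≈ (refl {𝕩}) (+-cong 𝟙≈1# (refl {𝕦}))) (refl {𝐖}))
                  (·-≈ (+ 2) (⊛-≈ (⊛-≈ (⊛-≈ (refl {𝕦}) (refl {𝕩})) (refl {𝕩}))
                                  (+-cong (+-cong (⊛-≈ (refl {𝓜}) (refl {𝐖})) (⊛-≈ (refl {𝐌}) (refl {𝓦})))
                                          (⊛-≈ (refl {𝓦}) (refl {𝓟})))))

  𝐖-closed-form : ∀ (n k : ℕ) → (𝐖 ⊛ (Q ⊛ Q)) n k ≡ ((+ 2) · (𝕦 ⊛ 𝕩 ⊛ 𝕩)) n k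
  𝐖-closed-form = trans (⊛-≈ (refl {𝐖}) (⊛-≈ Q≈Q′ Q≈Q′))
    (trans 𝐖*Q′*Q′ (sym (·-≈ (+ 2) (⊛-≈ (⊛-≈ (refl {𝕦}) (refl {𝕩})) (refl {𝕩})))))

open FunctionalEquations using (𝐖-equation; 𝐖-closed-form)

proposition3p5 :
    (∀ (n k : ℕ) →
      𝐖 n k ≡ ((𝕩 ⊛ (𝟙 ⊕ 𝕦) ⊛ 𝐖)
               ⊕ (+ 2) · (𝕦 ⊛ 𝕩 ⊛ 𝕩 ⊛ (𝓜 ⊛ 𝐖 ⊕ 𝐌 ⊛ 𝓦 ⊕ 𝓦 ⊛ ∂x (𝕩 ⊛ 𝓜)))) n k)
    × (∀ (n k : ℕ) →
      (𝐖 ⊛ (Q ⊛ Q)) n k ≡ ((+ 2) · (𝕦 ⊛ 𝕩 ⊛ 𝕩)) n k)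
proposition3p5 = 𝐖-equation , 𝐖-closed-form
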